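{- Let $k\ge 2$ be an integer. If multisets $f$ and $g$ on $\mathbb{Z}_2^{k-1}$ have distinguishing number $k$, then some element of $\mathbb{Z}_2^{k-1}$ has multiplicity at least $k$ in $f$ or in $g$ (i.e. $f(x)\ge k$ or $g(x)\ge k$ for some $x$).
   Context: A multiset on $\mathbb{Z}_2^m$ is a function $\phi:\mathbb{Z}_2^m\to\mathbb{N}$; $\phi(x)$ is the multiplicity of $x$. Its $i$-deck is $\mathrm{deck}_i\phi(s_1,\dots,s_i)=\sum_{g\in\mathbb{Z}_2^m}\phi(g+s_1)\cdots\phi(g+s_i)$. Two multisets are $k$-indistinguishable if their $i$-decks agree for all $i\le k$, and $k$-distinguishable otherwise; their distinguishing number is the smallest $k$ for which they are $k$-distinguishable. -}

module Defs where

open import Data.Nat using (ℕ; zero; suc; _+_; _*_; _≤_)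
open import Data.Bool using (Bool; true; false; _xor_)
open import Data.Vec using (Vec; []; _∷_; zipWith; foldr)
open import Data.List using (List; []; _∷_; map; _++_)
open import Data.Nat.ListAction using (sum)
open import Relation.Binary.PropositionalEquality using (_≡_)
open import Relation.Nullary using (¬_)
open import Data.Product using (Σ; _×_)

Z2^ : ℕ → Set
Z2^ m = Vec Bool m

_⊕_ : ∀ {m} → Z2^ m → Z2^ m → Z2^ m
_⊕_ = zipWith _xor_

elems : (m : ℕ) → List (Z2^ m)
elems zero = [] ∷ []
elems (suc m) = map (false ∷_) (elems m) ++ map (true ∷_) (elems m)

Multiset : ℕ → Set
Multiset m = Z2^ m → ℕ

prodShift : ∀ {m i} → Multiset m → Z2^ m → Vec (Z2^ m) i → ℕ
prodShift φ g ss = foldr _ (λ s acc → φ (g ⊕ s) * acc) 1 ss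

deck : ∀ {m} (i : ℕ) → Multiset m → Vec (Z2^ m) i → ℕ
deck {m} i φ ss = sum (map (λ g → prodShift φ g ss) (elems m))

Indist : ∀ {m} → ℕ → Multiset m → Multiset m → Set
Indist {m} k φ ψ = ∀ i → i ≤ k → (ss : Vec (Z2^ m) i) → deck i φ ss ≡ deck i ψ ss

Dist : ∀ {m} → ℕ → Multiset m → Multiset m → Set
Dist k φ ψ = ¬ Indist k φ ψ

-- distinguishing number is k: smallest k with k-distinguishable.
-- Since k-distinguishability is monotone in k, this is: k-distinguishable
-- and not j-distinguishable for every j < k.
DistNum : ∀ {m} → Multiset m → Multiset m → ℕ → Set
DistNum φ ψ k = Dist k φ ψ × (∀ j → suc j ≤ k → ¬ Dist j φ ψ)

-- Let F̂ be the Fourier transform on Z₂ⁿ, n = k − 1. The i-decks of f and g agree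
-- iff F̂f(a₁)⋯F̂f(aᵢ) = F̂g(a₁)⋯F̂g(aᵢ) for every i-tuple with a₁ + ⋯ + aᵢ = 0. Suppose all
-- multiplicities are at most n, the decks of order ≤ n agree, and a zero-sum tuple
-- (c, a₁, …, aₙ) separates f from g. The 2-deck gives F̂f² = F̂g², so the two products are
-- opposite; splitting the tuple into shorter zero-sum tuples shows that the aⱼ are linearly
-- independent and that F̂f and F̂g vanish at every sum of 2, …, n − 1 of the aⱼ. Fourier
-- inversion along the aⱼ then writes each multiplicity as 2⁻ⁿ (F̂(0) + Σⱼ ±F̂(aⱼ) ± F̂(c)),
-- with F̂(c) entering f and g with opposite signs. Integrality gives |F̂f(aⱼ)| ≥ 2ⁿ⁻¹, and then
-- the bounds 0 ≤ f, g ≤ n force F̂f(c) = 0, contradicting the separation. In dimension 1 the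
-- claim is a direct check.

module Submission where

open import Defs
open import Data.Nat using (ℕ; suc; _≤_)
open import Data.Product using (Σ)
open import Data.Sum using (_⊎_)
open import Relation.Binary.PropositionalEquality using (_≡_)

open import Algebra.Bundles using (CommutativeRing)
open import Data.Bool using (Bool; true; false; _xor_; _∧_; not)
import Data.Bool.Properties as Bool
open import Data.Empty using (⊥; ⊥-elim)
open import Data.Integer as ℤ using (ℤ; +_; -_; 0ℤ; 1ℤ; -1ℤ; _+_; _*_; _-_; ∣_∣)
open import Data.Integer.Divisibility.Signed using (_∣_; divides; ∣⇒∣ᵤ; ∣m∣n⇒∣m-n)
import Data.Integer.Properties as ℤ
open import Data.Integer.Tactic.RingSolver using (solve-∀)
import Data.List as L
import Data.List.Properties as L
open import Data.Nat as ℕ using (zero; z≤n; s≤s)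
open import Data.Nat.Divisibility using (∣⇒≤) renaming (_∣_ to _ℕ∣_)
open import Data.Nat.ListAction using (sum)
open import Data.Nat.ListAction.Properties using (sum-++)
import Data.Nat.Properties as ℕ
open import Data.Product using (_×_; _,_; proj₁; proj₂)
import Data.Product as Product
open import Data.Sum using (inj₁; inj₂; [_,_]′)
open import Data.Vec using (Vec; []; _∷_; zipWith; replicate; map)
import Data.Vec as V
open import Data.Vec.Relation.Binary.Pointwise.Inductive
  using (Pointwise-≡⇒≡; zipWith-comm; zipWith-assoc; zipWith-identityˡ; zipWith-identityʳ)
open import Data.Vec.Relation.Unary.All using (All; []; _∷_)
open import Function using (_∘_; id)
open import Relation.Binary.PropositionalEquality
  using (_≢_; refl; sym; trans; cong; cong₂; subst; subst₂; module ≡-Reasoning)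
open import Relation.Nullary using (yes; no)
open import Relation.Nullary.Decidable using (decidable-stable)

open import Algebra.Properties.CommutativeSemigroup
  (CommutativeRing.+-commutativeSemigroup Bool.xor-∧-commutativeRing)
  using () renaming (interchange to xor-interchange)
open import Algebra.Properties.CommutativeSemigroup ℤ.+-commutativeSemigroup
  using () renaming (interchange to +-interchange)
open import Algebra.Properties.CommutativeSemigroup ℤ.*-commutativeSemigroup
  using () renaming (x∙yz≈y∙xz to *-leftSwap; interchange to *-interchange)
open import Algebra.Properties.CommutativeSemigroup ℕ.+-commutativeSemigroup
  using () renaming (interchange to ℕ-+-interchange)

variable
  n k : ℕ

0ⁿ : Z2^ n
0ⁿ = replicate _ false

1ⁿ : Z2^ n
1ⁿ = replicate _ true

⊕-comm : (x y : Z2^ n) → x ⊕ y ≡ y ⊕ x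
⊕-comm x y = Pointwise-≡⇒≡ (zipWith-comm Bool.xor-comm x y)

⊕-assoc : (x y z : Z2^ n) → (x ⊕ y) ⊕ z ≡ x ⊕ (y ⊕ z)
⊕-assoc x y z = Pointwise-≡⇒≡ (zipWith-assoc Bool.xor-assoc x y z)

⊕-identityˡ : (x : Z2^ n) → 0ⁿ ⊕ x ≡ x
⊕-identityˡ x = Pointwise-≡⇒≡ (zipWith-identityˡ Bool.xor-identityˡ x)

⊕-identityʳ : (x : Z2^ n) → x ⊕ 0ⁿ ≡ x
⊕-identityʳ x = Pointwise-≡⇒≡ (zipWith-identityʳ Bool.xor-identityʳ x)

⊕-self : (x : Z2^ n) → x ⊕ x ≡ 0ⁿ
⊕-self []      = refl
⊕-self (b ∷ x) = cong₂ _∷_ (Bool.xor-same b) (⊕-self x)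

⊕-cancelʳ : (x y : Z2^ n) → (x ⊕ y) ⊕ y ≡ x
⊕-cancelʳ x y = trans (⊕-assoc x y y) (trans (cong (x ⊕_) (⊕-self y)) (⊕-identityʳ x))

⊕≡0⇒≡ : (x y : Z2^ n) → x ⊕ y ≡ 0ⁿ → x ≡ y
⊕≡0⇒≡ x y x⊕y≡0 = trans (sym (⊕-cancelʳ x y)) (trans (cong (_⊕ y) x⊕y≡0) (⊕-identityˡ y))

≡⇒⊕≡0 : {x y : Z2^ n} → x ≡ y → x ⊕ y ≡ 0ⁿ
≡⇒⊕≡0 {y = y} refl = ⊕-self y

-- Characters of Z₂ⁿ

sgn : Bool → ℤ
sgn false = 1ℤ
sgn true  = -1ℤ

sgn-xor : ∀ p q → sgn (p xor q) ≡ sgn p * sgn q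
sgn-xor false false = refl
sgn-xor false true  = refl
sgn-xor true  false = refl
sgn-xor true  true  = refl

sgn-not : ∀ p → sgn (not p) ≡ - sgn p
sgn-not false = refl
sgn-not true  = refl

sgn-1-or-−1 : ∀ p → sgn p ≡ 1ℤ ⊎ sgn p ≡ -1ℤ
sgn-1-or-−1 false = inj₁ refl
sgn-1-or-−1 true  = inj₂ refl

dot : Z2^ n → Z2^ n → Bool
dot []      []      = false
dot (b ∷ a) (c ∷ x) = (b ∧ c) xor dot a x

dot-⊕ʳ : (a x y : Z2^ n) → dot a (x ⊕ y) ≡ dot a x xor dot a y
dot-⊕ʳ []      []      []      = refl
dot-⊕ʳ (b ∷ a) (c ∷ x) (d ∷ y) rewrite dot-⊕ʳ a x y | Bool.∧-distribˡ-xor b c d =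
  xor-interchange (b ∧ c) (b ∧ d) (dot a x) (dot a y)

dot-comm : (a x : Z2^ n) → dot a x ≡ dot x a
dot-comm []      []      = refl
dot-comm (b ∷ a) (c ∷ x) = cong₂ _xor_ (Bool.∧-comm b c) (dot-comm a x)

dot-0ʳ : (a : Z2^ n) → dot a 0ⁿ ≡ false
dot-0ʳ []      = refl
dot-0ʳ (b ∷ a) = cong₂ _xor_ (Bool.∧-zeroʳ b) (dot-0ʳ a)

χ : Z2^ n → Z2^ n → ℤ
χ a x = sgn (dot a x)

χ-comm : (a x : Z2^ n) → χ a x ≡ χ x a
χ-comm a x = cong sgn (dot-comm a x)

χ-⊕ʳ : (a x y : Z2^ n) → χ a (x ⊕ y) ≡ χ a x * χ a y
χ-⊕ʳ a x y = trans (cong sgn (dot-⊕ʳ a x y)) (sgn-xor (dot a x) (dot a y))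

χ-⊕ˡ : (a b x : Z2^ n) → χ (a ⊕ b) x ≡ χ a x * χ b x
χ-⊕ˡ a b x = begin
  χ (a ⊕ b) x     ≡⟨ χ-comm (a ⊕ b) x ⟩
  χ x (a ⊕ b)     ≡⟨ χ-⊕ʳ x a b ⟩
  χ x a * χ x b   ≡⟨ cong₂ _*_ (χ-comm x a) (χ-comm x b) ⟩
  χ a x * χ b x   ∎
  where open ≡-Reasoning

χ-0ʳ : (a : Z2^ n) → χ a 0ⁿ ≡ 1ℤ
χ-0ʳ a = cong sgn (dot-0ʳ a)

χ-0ˡ : (x : Z2^ n) → χ 0ⁿ x ≡ 1ℤ
χ-0ˡ x = trans (χ-comm 0ⁿ x) (χ-0ʳ x)

χ-∷false : ∀ s (σ T : Z2^ n) → χ (s ∷ σ) (false ∷ T) ≡ χ σ T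
χ-∷false false σ T = refl
χ-∷false true  σ T = refl

χ-∷true : ∀ s (σ T : Z2^ n) → χ (s ∷ σ) (true ∷ T) ≡ sgn s * χ σ T
χ-∷true false σ T = sym (ℤ.*-identityˡ _)
χ-∷true true  σ T = sgn-xor true (dot σ T)

-- Sums over Z₂ⁿ and Fourier inversion

∑ : (Z2^ n → ℤ) → ℤ
∑ {zero}  h = h []
∑ {suc n} h = ∑ (λ x → h (false ∷ x)) + ∑ (λ x → h (true ∷ x))

infix 2 ∑
syntax ∑ (λ x → e) = ∑[ x ] e

∑-cong : {h h′ : Z2^ n → ℤ} → (∀ x → h x ≡ h′ x) → ∑ h ≡ ∑ h′
∑-cong {zero}  e = e []
∑-cong {suc n} e = cong₂ _+_ (∑-cong (λ x → e (false ∷ x))) (∑-cong (λ x → e (true ∷ x)))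

∑-distrib-+ : (h h′ : Z2^ n → ℤ) → (∑[ x ] h x + h′ x) ≡ ∑ h + ∑ h′
∑-distrib-+ {zero}  h h′ = refl
∑-distrib-+ {suc n} h h′ =
  trans (cong₂ _+_ (∑-distrib-+ (λ x → h (false ∷ x)) (λ x → h′ (false ∷ x)))
                   (∑-distrib-+ (λ x → h (true ∷ x)) (λ x → h′ (true ∷ x))))
        (+-interchange (∑[ x ] h (false ∷ x)) (∑[ x ] h′ (false ∷ x)) _ _)

∑-*ˡ : (c : ℤ) (h : Z2^ n → ℤ) → (∑[ x ] c * h x) ≡ c * ∑ h
∑-*ˡ {zero}  c h = refl
∑-*ˡ {suc n} c h =
  trans (cong₂ _+_ (∑-*ˡ c (λ x → h (false ∷ x))) (∑-*ˡ c (λ x → h (true ∷ x))))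
        (sym (ℤ.*-distribˡ-+ c _ _))

∑-*ʳ : (c : ℤ) (h : Z2^ n → ℤ) → (∑[ x ] h x * c) ≡ ∑ h * c
∑-*ʳ c h = trans (∑-cong (λ x → ℤ.*-comm (h x) c)) (trans (∑-*ˡ c h) (ℤ.*-comm c _))

∑-zero : (h : Z2^ n → ℤ) → (∀ x → h x ≡ 0ℤ) → ∑ h ≡ 0ℤ
∑-zero {zero}  h e = e []
∑-zero {suc n} h e =
  cong₂ _+_ (∑-zero (λ x → h (false ∷ x)) (λ x → e (false ∷ x)))
            (∑-zero (λ x → h (true ∷ x)) (λ x → e (true ∷ x)))

∑-comm : (h : Z2^ n → Z2^ k → ℤ) → (∑[ x ] ∑[ y ] h x y) ≡ (∑[ y ] ∑[ x ] h x y)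
∑-comm {zero}  h = refl
∑-comm {suc n} h = trans (cong₂ _+_ (∑-comm (λ x → h (false ∷ x))) (∑-comm (λ x → h (true ∷ x))))
                         (sym (∑-distrib-+ (λ y → ∑[ x ] h (false ∷ x) y)
                                           (λ y → ∑[ x ] h (true ∷ x) y)))

∑-translate : (h : Z2^ n → ℤ) (t : Z2^ n) → (∑[ x ] h (x ⊕ t)) ≡ ∑ h
∑-translate {zero}  h []          = refl
∑-translate {suc n} h (false ∷ t) =
  cong₂ _+_ (∑-translate (λ x → h (false ∷ x)) t) (∑-translate (λ x → h (true ∷ x)) t)
∑-translate {suc n} h (true ∷ t)  =
  trans (cong₂ _+_ (∑-translate (λ x → h (true ∷ x)) t) (∑-translate (λ x → h (false ∷ x)) t))
        (ℤ.+-comm (∑[ x ] h (true ∷ x)) (∑[ x ] h (false ∷ x)))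

∑-mono-≤ : {h h′ : Z2^ n → ℤ} → (∀ x → h x ℤ.≤ h′ x) → ∑ h ℤ.≤ ∑ h′
∑-mono-≤ {zero}  e = e []
∑-mono-≤ {suc n} e = ℤ.+-mono-≤ (∑-mono-≤ (λ x → e (false ∷ x))) (∑-mono-≤ (λ x → e (true ∷ x)))

∑-neg : (h : Z2^ n → ℤ) → (∑[ x ] - h x) ≡ - ∑ h
∑-neg {zero}  h = refl
∑-neg {suc n} h =
  trans (cong₂ _+_ (∑-neg (λ x → h (false ∷ x))) (∑-neg (λ x → h (true ∷ x))))
        (sym (ℤ.neg-distrib-+ (∑[ x ] h (false ∷ x)) (∑[ x ] h (true ∷ x))))

2^ : ℕ → ℤ
2^ n = + (2 ℕ.^ n)

2^-suc : ∀ n → 2^ (suc n) ≡ 2^ n + 2^ n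
2^-suc n = trans (cong (λ m → + (2 ℕ.^ n ℕ.+ m)) (ℕ.+-identityʳ (2 ℕ.^ n)))
                 (ℤ.pos-+ (2 ℕ.^ n) (2 ℕ.^ n))

2^≢0 : ∀ n → 2^ n ≢ 0ℤ
2^≢0 n e = ℕ.≢-nonZero⁻¹ (2 ℕ.^ n) {{ℕ.m^n≢0 2 n}} (ℤ.+-injective e)

δ₀ : Z2^ n → ℤ
δ₀ []          = 1ℤ
δ₀ (false ∷ x) = δ₀ x
δ₀ (true ∷ x)  = 0ℤ

δ₀-0ⁿ : δ₀ {n} 0ⁿ ≡ 1ℤ
δ₀-0ⁿ {zero}  = refl
δ₀-0ⁿ {suc n} = δ₀-0ⁿ {n}

δ₀≡0⊎≡0ⁿ : (x : Z2^ n) → δ₀ x ≡ 0ℤ ⊎ x ≡ 0ⁿ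
δ₀≡0⊎≡0ⁿ []          = inj₂ refl
δ₀≡0⊎≡0ⁿ (true ∷ x)  = inj₁ refl
δ₀≡0⊎≡0ⁿ (false ∷ x) with δ₀≡0⊎≡0ⁿ x
... | inj₁ e = inj₁ e
... | inj₂ e = inj₂ (cong (false ∷_) e)

∑χ : (a : Z2^ n) → (∑[ x ] χ a x) ≡ 2^ n * δ₀ a
∑χ []              = refl
∑χ {suc n} (false ∷ a) =
  trans (cong₂ _+_ (∑χ a) (∑χ a))
        (trans (sym (ℤ.*-distribʳ-+ (δ₀ a) (2^ n) (2^ n))) (cong (_* δ₀ a) (sym (2^-suc n))))
∑χ {suc n} (true ∷ a)  = begin
  ∑ (χ a) + (∑[ x ] sgn (not (dot a x)))  ≡⟨ cong (λ z → ∑ (χ a) + z) (∑-cong (λ x → sgn-not (dot a x))) ⟩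
  ∑ (χ a) + (∑[ x ] - χ a x)              ≡⟨ cong (λ z → ∑ (χ a) + z) (∑-neg (χ a)) ⟩
  ∑ (χ a) - ∑ (χ a)                       ≡⟨ ℤ.+-inverseʳ (∑ (χ a)) ⟩
  0ℤ                                      ≡⟨ ℤ.*-zeroʳ (2^ (suc n)) ⟨
  2^ (suc n) * 0ℤ                         ∎
  where open ≡-Reasoning

∑χ-dual : (x : Z2^ n) → (∑[ a ] χ a x) ≡ 2^ n * δ₀ x
∑χ-dual x = trans (∑-cong (λ a → χ-comm a x)) (∑χ x)

∑-δ₀ : (h : Z2^ n → ℤ) (y : Z2^ n) → (∑[ x ] h x * δ₀ (x ⊕ y)) ≡ h y
∑-δ₀ h [] = ℤ.*-identityʳ (h [])
∑-δ₀ h (false ∷ y) =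
  trans (cong₂ _+_ (∑-δ₀ (λ x → h (false ∷ x)) y)
                   (∑-zero _ (λ x → ℤ.*-zeroʳ (h (true ∷ x)))))
        (ℤ.+-identityʳ (h (false ∷ y)))
∑-δ₀ h (true ∷ y) =
  trans (cong₂ _+_ (∑-zero _ (λ x → ℤ.*-zeroʳ (h (false ∷ x))))
                   (∑-δ₀ (λ x → h (true ∷ x)) y))
        (ℤ.+-identityˡ (h (true ∷ y)))

F̂ : Multiset n → Z2^ n → ℤ
F̂ f a = ∑[ x ] + f x * χ a x

F̂-translate : (f : Multiset n) (g a : Z2^ n) → (∑[ s ] + f (g ⊕ s) * χ a s) ≡ χ a g * F̂ f a
F̂-translate f g a = begin
  (∑[ s ] + f (g ⊕ s) * χ a s)
    ≡⟨ ∑-cong (λ s → cong₂ (λ u v → + f u * χ a v) (⊕-comm g s) (sym (⊕-cancelʳ s g))) ⟩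
  (∑[ s ] + f (s ⊕ g) * χ a ((s ⊕ g) ⊕ g))
    ≡⟨ ∑-translate (λ s → + f s * χ a (s ⊕ g)) g ⟩
  (∑[ s ] + f s * χ a (s ⊕ g))
    ≡⟨ ∑-cong (λ s → trans (cong (+ f s *_) (χ-⊕ʳ a s g)) (sym (ℤ.*-assoc (+ f s) (χ a s) (χ a g)))) ⟩
  (∑[ s ] (+ f s * χ a s) * χ a g)
    ≡⟨ ∑-*ʳ (χ a g) (λ s → + f s * χ a s) ⟩
  F̂ f a * χ a g
    ≡⟨ ℤ.*-comm (F̂ f a) (χ a g) ⟩
  χ a g * F̂ f a ∎
  where open ≡-Reasoning

F̂-inversion : (f : Multiset n) (y : Z2^ n) → (∑[ b ] F̂ f b * χ b y) ≡ 2^ n * + f y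
F̂-inversion {n} f y = begin
  (∑[ b ] F̂ f b * χ b y)
    ≡⟨ ∑-cong (λ b → sym (∑-*ʳ (χ b y) (λ x → + f x * χ b x))) ⟩
  (∑[ b ] ∑[ x ] (+ f x * χ b x) * χ b y)
    ≡⟨ ∑-comm (λ b x → (+ f x * χ b x) * χ b y) ⟩
  (∑[ x ] ∑[ b ] (+ f x * χ b x) * χ b y)
    ≡⟨ ∑-cong (λ x → trans (∑-cong (λ b → regroup x b)) (∑-*ˡ (+ f x) (λ b → χ b (x ⊕ y)))) ⟩
  (∑[ x ] + f x * (∑[ b ] χ b (x ⊕ y)))
    ≡⟨ ∑-cong (λ x → cong (+ f x *_) (∑χ-dual (x ⊕ y))) ⟩
  (∑[ x ] + f x * (2^ n * δ₀ (x ⊕ y)))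
    ≡⟨ ∑-cong (λ x → *-leftSwap (+ f x) (2^ n) (δ₀ (x ⊕ y))) ⟩
  (∑[ x ] 2^ n * (+ f x * δ₀ (x ⊕ y)))
    ≡⟨ ∑-*ˡ (2^ n) (λ x → + f x * δ₀ (x ⊕ y)) ⟩
  2^ n * (∑[ x ] + f x * δ₀ (x ⊕ y))
    ≡⟨ cong (2^ n *_) (∑-δ₀ (λ x → + f x) y) ⟩
  2^ n * + f y ∎
  where
  open ≡-Reasoning
  regroup : ∀ x b → (+ f x * χ b x) * χ b y ≡ + f x * χ b (x ⊕ y)
  regroup x b = trans (ℤ.*-assoc (+ f x) (χ b x) (χ b y)) (cong (+ f x *_) (sym (χ-⊕ʳ b x y)))

sum-elems : (h : Z2^ n → ℕ) → + sum (L.map h (elems n)) ≡ (∑[ x ] + h x)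
sum-elems {zero}  h = cong +_ (ℕ.+-identityʳ (h []))
sum-elems {suc n} h = begin
  + sum (L.map h (L.map (false ∷_) (elems n) L.++ L.map (true ∷_) (elems n)))
    ≡⟨ cong (λ xs → + sum xs) (L.map-++ h (L.map (false ∷_) (elems n)) _) ⟩
  + sum (L.map h (L.map (false ∷_) (elems n)) L.++ L.map h (L.map (true ∷_) (elems n)))
    ≡⟨ cong +_ (sum-++ (L.map h (L.map (false ∷_) (elems n))) _) ⟩
  + (sum (L.map h (L.map (false ∷_) (elems n))) ℕ.+ sum (L.map h (L.map (true ∷_) (elems n))))
    ≡⟨ ℤ.pos-+ (sum (L.map h (L.map (false ∷_) (elems n)))) _ ⟩
  + sum (L.map h (L.map (false ∷_) (elems n))) + + sum (L.map h (L.map (true ∷_) (elems n)))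
    ≡⟨ cong₂ (λ u v → + sum u + + sum v) (sym (L.map-∘ (elems n))) (sym (L.map-∘ (elems n))) ⟩
  + sum (L.map (λ x → h (false ∷ x)) (elems n)) + + sum (L.map (λ x → h (true ∷ x)) (elems n))
    ≡⟨ cong₂ _+_ (sum-elems (λ x → h (false ∷ x))) (sum-elems (λ x → h (true ∷ x))) ⟩
  (∑[ x ] + h (false ∷ x)) + (∑[ x ] + h (true ∷ x)) ∎
  where open ≡-Reasoning

-- Decks in terms of the Fourier transform

∑ᵛ : ∀ i → (Vec (Z2^ n) i → ℤ) → ℤ
∑ᵛ zero    h = h []
∑ᵛ (suc i) h = ∑[ s ] ∑ᵛ i (λ ss → h (s ∷ ss))

∑ᵛ-cong : ∀ i {h h′ : Vec (Z2^ n) i → ℤ} → (∀ ss → h ss ≡ h′ ss) → ∑ᵛ i h ≡ ∑ᵛ i h′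
∑ᵛ-cong zero    e = e []
∑ᵛ-cong (suc i) e = ∑-cong (λ s → ∑ᵛ-cong i (λ ss → e (s ∷ ss)))

∑ᵛ-*ˡ : ∀ i (c : ℤ) (h : Vec (Z2^ n) i → ℤ) → ∑ᵛ i (λ ss → c * h ss) ≡ c * ∑ᵛ i h
∑ᵛ-*ˡ zero    c h = refl
∑ᵛ-*ˡ (suc i) c h =
  trans (∑-cong (λ s → ∑ᵛ-*ˡ i c (λ ss → h (s ∷ ss)))) (∑-*ˡ c (λ s → ∑ᵛ i (λ ss → h (s ∷ ss))))

∑ᵛ-∑-comm : ∀ i (h : Vec (Z2^ n) i → Z2^ k → ℤ) →
  ∑ᵛ i (λ ss → ∑[ g ] h ss g) ≡ (∑[ g ] ∑ᵛ i (λ ss → h ss g))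
∑ᵛ-∑-comm zero    h = refl
∑ᵛ-∑-comm (suc i) h = trans (∑-cong (λ s → ∑ᵛ-∑-comm i (λ ss → h (s ∷ ss))))
                            (∑-comm (λ s g → ∑ᵛ i (λ ss → h (s ∷ ss) g)))

∏ : {A : Set} → (A → ℤ) → Vec A k → ℤ
∏ u []       = 1ℤ
∏ u (x ∷ xs) = u x * ∏ u xs

infix 2 ∏
syntax ∏ (λ x → e) xs = ∏[ x ∈ xs ] e

∏₂ : {A B : Set} → (A → B → ℤ) → Vec A k → Vec B k → ℤ
∏₂ u []       []       = 1ℤ
∏₂ u (x ∷ xs) (y ∷ ys) = u x y * ∏₂ u xs ys

vsum : Vec (Z2^ n) k → Z2^ n
vsum []       = 0ⁿ
vsum (x ∷ xs) = x ⊕ vsum xs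

∏-cong : {A : Set} {u v : A → ℤ} (xs : Vec A k) → (∀ x → u x ≡ v x) → ∏ u xs ≡ ∏ v xs
∏-cong []       e = refl
∏-cong (x ∷ xs) e = cong₂ _*_ (e x) (∏-cong xs e)

∏-map : {A : Set} (u : A → ℤ) (xs : Vec A k) → (∏[ b ∈ map u xs ] b) ≡ ∏ u xs
∏-map u []       = refl
∏-map u (x ∷ xs) = cong (u x *_) (∏-map u xs)

∏-distrib-* : {A : Set} (u v : A → ℤ) (xs : Vec A k) → (∏[ x ∈ xs ] u x * v x) ≡ ∏ u xs * ∏ v xs
∏-distrib-* u v []       = refl
∏-distrib-* u v (x ∷ xs) =
  trans (cong (u x * v x *_) (∏-distrib-* u v xs)) (*-interchange (u x) (v x) (∏ u xs) (∏ v xs))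

∏-*ˡ : {A : Set} (c : ℤ) (u : A → ℤ) (xs : Vec A k) → (∏[ x ∈ xs ] c * u x) ≡ c ℤ.^ k * ∏ u xs
∏-*ˡ c u []                   = refl
∏-*ˡ {k = suc k} c u (x ∷ xs) =
  trans (cong (c * u x *_) (∏-*ˡ c u xs)) (*-interchange c (u x) (c ℤ.^ k) (∏ u xs))

∏-χ : (as : Vec (Z2^ n) k) (g : Z2^ n) → (∏[ a ∈ as ] χ a g) ≡ χ (vsum as) g
∏-χ []       g = sym (χ-0ˡ g)
∏-χ (a ∷ as) g = trans (cong (χ a g *_) (∏-χ as g)) (sym (χ-⊕ˡ a (vsum as) g))

∏-*-∏₂ : {A B : Set} (u : B → ℤ) (w : A → B → ℤ) (xs : Vec A k) (ys : Vec B k) →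
  ∏ u ys * ∏₂ w xs ys ≡ ∏₂ (λ x y → u y * w x y) xs ys
∏-*-∏₂ u w []       []       = refl
∏-*-∏₂ u w (x ∷ xs) (y ∷ ys) =
  trans (*-interchange (u y) (∏ u ys) (w x y) (∏₂ w xs ys)) (cong (u y * w x y *_) (∏-*-∏₂ u w xs ys))

∏-squares : {A : Set} (u v : A → ℤ) → (∀ x → u x * u x ≡ v x * v x) →
  (xs : Vec A k) → ∏ u xs * ∏ u xs ≡ ∏ v xs * ∏ v xs
∏-squares u v sq xs = begin
  ∏ u xs * ∏ u xs            ≡⟨ ∏-distrib-* u u xs ⟨
  (∏[ x ∈ xs ] u x * u x)    ≡⟨ ∏-cong xs sq ⟩
  (∏[ x ∈ xs ] v x * v x)    ≡⟨ ∏-distrib-* v v xs ⟩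
  ∏ v xs * ∏ v xs            ∎
  where open ≡-Reasoning

∑ᵛ-∏₂ : {A : Set} (u : A → Z2^ n → ℤ) (xs : Vec A k) →
  ∑ᵛ k (∏₂ u xs) ≡ (∏[ x ∈ xs ] ∑ (u x))
∑ᵛ-∏₂ u []                   = refl
∑ᵛ-∏₂ {k = suc k} u (x ∷ xs) = begin
  (∑[ s ] ∑ᵛ k (λ ss → u x s * ∏₂ u xs ss))   ≡⟨ ∑-cong (λ s → ∑ᵛ-*ˡ k (u x s) (∏₂ u xs)) ⟩
  (∑[ s ] u x s * ∑ᵛ k (∏₂ u xs))             ≡⟨ ∑-cong (λ s → cong (u x s *_) (∑ᵛ-∏₂ u xs)) ⟩
  (∑[ s ] u x s * (∏[ y ∈ xs ] ∑ (u y)))      ≡⟨ ∑-*ʳ (∏[ y ∈ xs ] ∑ (u y)) (u x) ⟩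
  ∑ (u x) * (∏[ y ∈ xs ] ∑ (u y))             ∎
  where open ≡-Reasoning

∏F̂ : Multiset n → Vec (Z2^ n) k → ℤ
∏F̂ f as = ∏[ a ∈ as ] F̂ f a

deck-as-∑ : ∀ i (f : Multiset n) (ss : Vec (Z2^ n) i) →
  + deck i f ss ≡ (∑[ g ] ∏[ s ∈ ss ] + f (g ⊕ s))
deck-as-∑ i f ss =
  trans (sum-elems (λ g → prodShift f g ss)) (∑-cong (λ g → prodShift-as-∏ g ss))
  where
  prodShift-as-∏ : ∀ {j} g (ss : Vec _ j) → + prodShift f g ss ≡ (∏[ s ∈ ss ] + f (g ⊕ s))
  prodShift-as-∏ g []       = refl
  prodShift-as-∏ g (s ∷ ss) =
    trans (ℤ.pos-* (f (g ⊕ s)) (prodShift f g ss)) (cong (+ f (g ⊕ s) *_) (prodShift-as-∏ g ss))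

deck-transform : ∀ i (f : Multiset n) (as : Vec (Z2^ n) i) →
  ∑ᵛ i (λ ss → + deck i f ss * ∏₂ χ as ss) ≡ (2^ n * δ₀ (vsum as)) * ∏F̂ f as
deck-transform {n} i f as = begin
  ∑ᵛ i (λ ss → + deck i f ss * ∏₂ χ as ss)
    ≡⟨ ∑ᵛ-cong i (λ ss → trans (cong (_* ∏₂ χ as ss) (deck-as-∑ i f ss))
                                (sym (∑-*ʳ (∏₂ χ as ss) (λ g → ∏[ s ∈ ss ] + f (g ⊕ s))))) ⟩
  ∑ᵛ i (λ ss → ∑[ g ] (∏[ s ∈ ss ] + f (g ⊕ s)) * ∏₂ χ as ss)
    ≡⟨ ∑ᵛ-∑-comm i (λ ss g → (∏[ s ∈ ss ] + f (g ⊕ s)) * ∏₂ χ as ss) ⟩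
  (∑[ g ] ∑ᵛ i (λ ss → (∏[ s ∈ ss ] + f (g ⊕ s)) * ∏₂ χ as ss))
    ≡⟨ ∑-cong (λ g → ∑ᵛ-cong i (λ ss → ∏-*-∏₂ (λ s → + f (g ⊕ s)) χ as ss)) ⟩
  (∑[ g ] ∑ᵛ i (∏₂ (λ a s → + f (g ⊕ s) * χ a s) as))
    ≡⟨ ∑-cong (λ g → ∑ᵛ-∏₂ (λ a s → + f (g ⊕ s) * χ a s) as) ⟩
  (∑[ g ] ∏[ a ∈ as ] ∑[ s ] + f (g ⊕ s) * χ a s)
    ≡⟨ ∑-cong (λ g → ∏-cong as (F̂-translate f g)) ⟩
  (∑[ g ] ∏[ a ∈ as ] χ a g * F̂ f a)
    ≡⟨ ∑-cong (λ g → trans (∏-distrib-* (λ a → χ a g) (F̂ f) as) (cong (_* ∏F̂ f as) (∏-χ as g))) ⟩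
  (∑[ g ] χ (vsum as) g * ∏F̂ f as)
    ≡⟨ ∑-*ʳ (∏F̂ f as) (χ (vsum as)) ⟩
  ∑ (χ (vsum as)) * ∏F̂ f as
    ≡⟨ cong (_* ∏F̂ f as) (∑χ (vsum as)) ⟩
  (2^ n * δ₀ (vsum as)) * ∏F̂ f as ∎
  where open ≡-Reasoning

deck-expansion : ∀ i (f : Multiset n) (ss : Vec (Z2^ n) i) →
  2^ n ℤ.^ i * + deck i f ss ≡ ∑ᵛ i (λ as → (∏F̂ f as * ∏₂ χ as ss) * (2^ n * δ₀ (vsum as)))
deck-expansion {n} i f ss = begin
  2^ n ℤ.^ i * + deck i f ss
    ≡⟨ cong (2^ n ℤ.^ i *_) (deck-as-∑ i f ss) ⟩
  2^ n ℤ.^ i * (∑[ g ] ∏[ s ∈ ss ] + f (g ⊕ s))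
    ≡⟨ ∑-*ˡ (2^ n ℤ.^ i) (λ g → ∏[ s ∈ ss ] + f (g ⊕ s)) ⟨
  (∑[ g ] 2^ n ℤ.^ i * (∏[ s ∈ ss ] + f (g ⊕ s)))
    ≡⟨ ∑-cong (λ g → ∏-*ˡ (2^ n) (λ s → + f (g ⊕ s)) ss) ⟨
  (∑[ g ] ∏[ s ∈ ss ] 2^ n * + f (g ⊕ s))
    ≡⟨ ∑-cong (λ g → ∏-cong ss (λ s → F̂-inversion f (g ⊕ s))) ⟨
  (∑[ g ] ∏[ s ∈ ss ] ∑[ b ] F̂ f b * χ b (g ⊕ s))
    ≡⟨ ∑-cong (λ g → ∑ᵛ-∏₂ (λ s b → F̂ f b * χ b (g ⊕ s)) ss) ⟨
  (∑[ g ] ∑ᵛ i (∏₂ (λ s b → F̂ f b * χ b (g ⊕ s)) ss))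
    ≡⟨ ∑ᵛ-∑-comm i (λ as g → ∏₂ (λ s b → F̂ f b * χ b (g ⊕ s)) ss as) ⟨
  ∑ᵛ i (λ as → ∑[ g ] ∏₂ (λ s b → F̂ f b * χ b (g ⊕ s)) ss as)
    ≡⟨ ∑ᵛ-cong i (λ as → trans (∑-cong (λ g → factor g ss as))
                               (∑-*ˡ (∏F̂ f as * ∏₂ χ as ss) (χ (vsum as)))) ⟩
  ∑ᵛ i (λ as → (∏F̂ f as * ∏₂ χ as ss) * ∑ (χ (vsum as)))
    ≡⟨ ∑ᵛ-cong i (λ as → cong ((∏F̂ f as * ∏₂ χ as ss) *_) (∑χ (vsum as))) ⟩
  ∑ᵛ i (λ as → (∏F̂ f as * ∏₂ χ as ss) * (2^ n * δ₀ (vsum as))) ∎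
  where
  open ≡-Reasoning
  factor : ∀ {j} g (ss as : Vec (Z2^ n) j) →
    ∏₂ (λ s b → F̂ f b * χ b (g ⊕ s)) ss as ≡ (∏F̂ f as * ∏₂ χ as ss) * χ (vsum as) g
  factor g []       []       = sym (trans (ℤ.*-identityˡ (χ 0ⁿ g)) (χ-0ˡ g))
  factor g (s ∷ ss) (b ∷ as) rewrite factor g ss as | χ-⊕ʳ b g s | χ-⊕ˡ b (vsum as) g =
    regroup (F̂ f b) (χ b g) (χ b s) (∏F̂ f as) (∏₂ χ as ss) (χ (vsum as) g)
    where
    regroup : ∀ A B C D E G → (A * (B * C)) * ((D * E) * G) ≡ ((A * D) * (C * E)) * (B * G)
    regroup = solve-∀

ZeroSumProductsAgree : ℕ → Multiset n → Multiset n → Set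
ZeroSumProductsAgree {n} i f g = (as : Vec (Z2^ n) i) → vsum as ≡ 0ⁿ → ∏F̂ f as ≡ ∏F̂ g as

*-cancelˡ-≢0 : ∀ c {x y} → c ≢ 0ℤ → c * x ≡ c * y → x ≡ y
*-cancelˡ-≢0 c c≢0 = ℤ.*-cancelˡ-≡ c _ _ {{ℤ.≢-nonZero c≢0}}

decks-agree⇒products-agree : ∀ i (f g : Multiset n) →
  (∀ ss → deck i f ss ≡ deck i g ss) → ZeroSumProductsAgree i f g
decks-agree⇒products-agree {n} i f g decks≡ as Σas≡0 =
  *-cancelˡ-≢0 (2^ n * δ₀ (vsum as)) scale≢0
    (trans (sym (deck-transform i f as))
      (trans (∑ᵛ-cong i (λ ss → cong (λ d → + d * ∏₂ χ as ss) (decks≡ ss))) (deck-transform i g as)))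
  where
  scale≢0 : 2^ n * δ₀ (vsum as) ≢ 0ℤ
  scale≢0 rewrite Σas≡0 | δ₀-0ⁿ {n} | ℤ.*-identityʳ (2^ n) = 2^≢0 n

products-agree⇒decks-agree : ∀ i (f g : Multiset n) →
  ZeroSumProductsAgree i f g → ∀ ss → deck i f ss ≡ deck i g ss
products-agree⇒decks-agree {n} i f g products≡ ss =
  ℤ.+-injective (*-cancelˡ-≢0 (2^ n ℤ.^ i) (λ e → 2^≢0 n (ℤ.i^n≡0⇒i≡0 (2^ n) i e))
    (trans (deck-expansion i f ss) (trans (∑ᵛ-cong i termwise) (sym (deck-expansion i g ss)))))
  where
  termwise : ∀ as → (∏F̂ f as * ∏₂ χ as ss) * (2^ n * δ₀ (vsum as))
                  ≡ (∏F̂ g as * ∏₂ χ as ss) * (2^ n * δ₀ (vsum as))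
  termwise as with δ₀≡0⊎≡0ⁿ (vsum as)
  ... | inj₁ δ≡0  rewrite δ≡0 | ℤ.*-zeroʳ (2^ n) | ℤ.*-zeroʳ (∏F̂ f as * ∏₂ χ as ss)
                          | ℤ.*-zeroʳ (∏F̂ g as * ∏₂ χ as ss) = refl
  ... | inj₂ Σas≡0 rewrite products≡ as Σas≡0 = refl

-- Subsums of a tuple and Fourier sums of sparse functions

wt : Z2^ k → ℕ
wt []          = 0
wt (true ∷ T)  = suc (wt T)
wt (false ∷ T) = wt T

wt-≤ : (T : Z2^ k) → wt T ≤ k
wt-≤ []          = z≤n
wt-≤ (true ∷ T)  = s≤s (wt-≤ T)
wt-≤ (false ∷ T) = ℕ.m≤n⇒m≤1+n (wt-≤ T)

wt-+-wt-not : (T : Z2^ k) → wt T ℕ.+ wt (map not T) ≡ k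
wt-+-wt-not []          = refl
wt-+-wt-not (true ∷ T)  = cong suc (wt-+-wt-not T)
wt-+-wt-not (false ∷ T) = trans (ℕ.+-suc (wt T) _) (cong suc (wt-+-wt-not T))

wt-not-bound : ∀ {m} (T : Z2^ k) → m ≤ wt T → m ℕ.+ wt (map not T) ≤ k
wt-not-bound {m = m} T m≤wt = subst (m ℕ.+ wt (map not T) ≤_) (wt-+-wt-not T) (ℕ.+-monoˡ-≤ (wt (map not T)) m≤wt)

sel : {A : Set} (T : Z2^ k) → Vec A k → Vec A (wt T)
sel []          []       = []
sel (true ∷ T)  (x ∷ xs) = x ∷ sel T xs
sel (false ∷ T) (x ∷ xs) = sel T xs

subsum : Z2^ k → Vec (Z2^ n) k → Z2^ n
subsum T as = vsum (sel T as)

∏-sel-split : {A : Set} (u : A → ℤ) (T : Z2^ k) (xs : Vec A k) →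
  ∏ u (sel T xs) * ∏ u (sel (map not T) xs) ≡ ∏ u xs
∏-sel-split u []          []       = refl
∏-sel-split u (true ∷ T)  (x ∷ xs) =
  trans (ℤ.*-assoc (u x) _ _) (cong (u x *_) (∏-sel-split u T xs))
∏-sel-split u (false ∷ T) (x ∷ xs) =
  trans (*-leftSwap (∏ u (sel T xs)) (u x) _) (cong (u x *_) (∏-sel-split u T xs))

∏F̂-split : (h : Multiset n) (c : Z2^ n) (T : Z2^ k) (as : Vec (Z2^ n) k) →
  ∏F̂ h (c ∷ as) ≡ ∏F̂ h (sel T as) * ∏F̂ h (c ∷ sel (map not T) as)
∏F̂-split h c T as = begin
  F̂ h c * ∏F̂ h as                                         ≡⟨ cong (F̂ h c *_) (∏-sel-split (F̂ h) T as) ⟨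
  F̂ h c * (∏F̂ h (sel T as) * ∏F̂ h (sel (map not T) as))   ≡⟨ *-leftSwap (F̂ h c) (∏F̂ h (sel T as)) _ ⟩
  ∏F̂ h (sel T as) * (F̂ h c * ∏F̂ h (sel (map not T) as))   ∎
  where open ≡-Reasoning

∏F̂-split-twice : (h : Multiset n) (y c : Z2^ n) (T : Z2^ k) (as : Vec (Z2^ n) k) →
  (F̂ h y * F̂ h y) * ∏F̂ h (c ∷ as) ≡ ∏F̂ h (y ∷ sel T as) * ∏F̂ h (y ∷ c ∷ sel (map not T) as)
∏F̂-split-twice h y c T as =
  trans (cong ((F̂ h y * F̂ h y) *_) (∏F̂-split h c T as))
        (*-interchange (F̂ h y) (F̂ h y) (∏F̂ h (sel T as)) (∏F̂ h (c ∷ sel (map not T) as)))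

subsum-split : (T : Z2^ k) (as : Vec (Z2^ n) k) → subsum T as ⊕ subsum (map not T) as ≡ vsum as
subsum-split []          []       = ⊕-self 0ⁿ
subsum-split (true ∷ T)  (a ∷ as) =
  trans (⊕-assoc a (subsum T as) _) (cong (a ⊕_) (subsum-split T as))
subsum-split (false ∷ T) (a ∷ as) = begin
  subsum T as ⊕ (a ⊕ subsum (map not T) as)   ≡⟨ ⊕-assoc (subsum T as) a _ ⟨
  (subsum T as ⊕ a) ⊕ subsum (map not T) as   ≡⟨ cong (_⊕ subsum (map not T) as) (⊕-comm (subsum T as) a) ⟩
  (a ⊕ subsum T as) ⊕ subsum (map not T) as   ≡⟨ ⊕-assoc a (subsum T as) _ ⟩
  a ⊕ (subsum T as ⊕ subsum (map not T) as)   ≡⟨ cong (a ⊕_) (subsum-split T as) ⟩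
  a ⊕ vsum as                                 ∎
  where open ≡-Reasoning

subsum-0ⁿ : (as : Vec (Z2^ n) k) → subsum 0ⁿ as ≡ 0ⁿ
subsum-0ⁿ []       = refl
subsum-0ⁿ (a ∷ as) = subsum-0ⁿ as

subsum-1ⁿ : (as : Vec (Z2^ n) k) → subsum 1ⁿ as ≡ vsum as
subsum-1ⁿ []       = refl
subsum-1ⁿ (a ∷ as) = cong (a ⊕_) (subsum-1ⁿ as)

unitValues : (Z2^ k → ℤ) → Vec ℤ k
unitValues {zero}  h = []
unitValues {suc k} h = h (true ∷ 0ⁿ) ∷ unitValues (λ T → h (false ∷ T))

signedSum : Z2^ k → Vec ℤ k → ℤ
signedSum []      []       = 0ℤ
signedSum (s ∷ σ) (b ∷ bs) = sgn s * b + signedSum σ bs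

unitValues-subsum : (u : Z2^ n → ℤ) (as : Vec (Z2^ n) k) →
  unitValues (λ T → u (subsum T as)) ≡ map u as
unitValues-subsum u []       = refl
unitValues-subsum u (a ∷ as) =
  cong₂ _∷_ (cong u (trans (cong (a ⊕_) (subsum-0ⁿ as)) (⊕-identityʳ a))) (unitValues-subsum u as)

∑χ-split : ∀ s (σ : Z2^ k) (h : Z2^ (suc k) → ℤ) →
  (∑[ T ] χ (s ∷ σ) T * h T)
    ≡ (∑[ T ] χ σ T * h (false ∷ T)) + sgn s * (∑[ T ] χ σ T * h (true ∷ T))
∑χ-split s σ h = cong₂ _+_
  (∑-cong (λ T → cong (_* h (false ∷ T)) (χ-∷false s σ T)))
  (trans (∑-cong (λ T → trans (cong (_* h (true ∷ T)) (χ-∷true s σ T))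
                              (ℤ.*-assoc (sgn s) (χ σ T) (h (true ∷ T)))))
         (∑-*ˡ (sgn s) (λ T → χ σ T * h (true ∷ T))))

∑χ-zero : (σ : Z2^ k) (h : Z2^ k → ℤ) → (∀ T → h T ≡ 0ℤ) → (∑[ T ] χ σ T * h T) ≡ 0ℤ
∑χ-zero σ h h≡0 = ∑-zero _ (λ T → trans (cong (χ σ T *_) (h≡0 T)) (ℤ.*-zeroʳ (χ σ T)))

∑χ-support-0 : (σ : Z2^ k) (h : Z2^ k → ℤ) → (∀ T → 1 ≤ wt T → h T ≡ 0ℤ) →
  (∑[ T ] χ σ T * h T) ≡ h 0ⁿ
∑χ-support-0 []      h _      = ℤ.*-identityˡ (h [])
∑χ-support-0 (s ∷ σ) h h≡0 = begin
  (∑[ T ] χ (s ∷ σ) T * h T)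
    ≡⟨ ∑χ-split s σ h ⟩
  (∑[ T ] χ σ T * h (false ∷ T)) + sgn s * (∑[ T ] χ σ T * h (true ∷ T))
    ≡⟨ cong₂ (λ u v → u + sgn s * v)
             (∑χ-support-0 σ (λ T → h (false ∷ T)) (λ T → h≡0 (false ∷ T)))
             (∑χ-zero σ (λ T → h (true ∷ T)) (λ T → h≡0 (true ∷ T) (s≤s z≤n))) ⟩
  h 0ⁿ + sgn s * 0ℤ
    ≡⟨ trans (cong (λ z → h 0ⁿ + z) (ℤ.*-zeroʳ (sgn s))) (ℤ.+-identityʳ (h 0ⁿ)) ⟩
  h 0ⁿ ∎
  where open ≡-Reasoning

∑χ-support-1ⁿ : (σ : Z2^ k) (h : Z2^ k → ℤ) → (∀ T → wt T ℕ.< k → h T ≡ 0ℤ) →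
  (∑[ T ] χ σ T * h T) ≡ χ σ 1ⁿ * h 1ⁿ
∑χ-support-1ⁿ []      h _   = refl
∑χ-support-1ⁿ (s ∷ σ) h h≡0 = begin
  (∑[ T ] χ (s ∷ σ) T * h T)
    ≡⟨ ∑χ-split s σ h ⟩
  (∑[ T ] χ σ T * h (false ∷ T)) + sgn s * (∑[ T ] χ σ T * h (true ∷ T))
    ≡⟨ cong₂ (λ u v → u + sgn s * v)
             (∑χ-zero σ (λ T → h (false ∷ T)) (λ T → h≡0 (false ∷ T) (s≤s (wt-≤ T))))
             (∑χ-support-1ⁿ σ (λ T → h (true ∷ T)) (λ T p → h≡0 (true ∷ T) (s≤s p))) ⟩
  0ℤ + sgn s * (χ σ 1ⁿ * h 1ⁿ)
    ≡⟨ trans (ℤ.+-identityˡ _) (sym (ℤ.*-assoc (sgn s) (χ σ 1ⁿ) (h 1ⁿ))) ⟩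
  sgn s * χ σ 1ⁿ * h 1ⁿ
    ≡⟨ cong (_* h 1ⁿ) (χ-∷true s σ 1ⁿ) ⟨
  χ (s ∷ σ) 1ⁿ * h 1ⁿ ∎
  where open ≡-Reasoning

∑χ-support-wt≤1 : (σ : Z2^ k) (h : Z2^ k → ℤ) → (∀ T → 2 ≤ wt T → h T ≡ 0ℤ) →
  (∑[ T ] χ σ T * h T) ≡ h 0ⁿ + signedSum σ (unitValues h)
∑χ-support-wt≤1 []      h _   = trans (ℤ.*-identityˡ (h [])) (sym (ℤ.+-identityʳ (h [])))
∑χ-support-wt≤1 (s ∷ σ) h h≡0 = begin
  (∑[ T ] χ (s ∷ σ) T * h T)
    ≡⟨ ∑χ-split s σ h ⟩
  (∑[ T ] χ σ T * h (false ∷ T)) + sgn s * (∑[ T ] χ σ T * h (true ∷ T))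
    ≡⟨ cong₂ (λ u v → u + sgn s * v)
             (∑χ-support-wt≤1 σ (λ T → h (false ∷ T)) (λ T → h≡0 (false ∷ T)))
             (∑χ-support-0 σ (λ T → h (true ∷ T)) (λ T p → h≡0 (true ∷ T) (s≤s p))) ⟩
  (h 0ⁿ + signedSum σ (unitValues (λ T → h (false ∷ T)))) + sgn s * h (true ∷ 0ⁿ)
    ≡⟨ regroup (h 0ⁿ) _ _ ⟩
  h 0ⁿ + (sgn s * h (true ∷ 0ⁿ) + signedSum σ (unitValues (λ T → h (false ∷ T)))) ∎
  where
  open ≡-Reasoning
  regroup : ∀ a b c → (a + b) + c ≡ a + (c + b)
  regroup = solve-∀

∑χ-support-0-1ⁿ : (σ : Z2^ (suc k)) (h : Z2^ (suc k) → ℤ) →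
  (∀ T → 1 ≤ wt T → wt T ℕ.< suc k → h T ≡ 0ℤ) → (∑[ T ] χ σ T * h T) ≡ h 0ⁿ + χ σ 1ⁿ * h 1ⁿ
∑χ-support-0-1ⁿ (s ∷ σ) h h≡0 = begin
  (∑[ T ] χ (s ∷ σ) T * h T)
    ≡⟨ ∑χ-split s σ h ⟩
  (∑[ T ] χ σ T * h (false ∷ T)) + sgn s * (∑[ T ] χ σ T * h (true ∷ T))
    ≡⟨ cong₂ (λ u v → u + sgn s * v)
             (∑χ-support-0 σ (λ T → h (false ∷ T)) (λ T p → h≡0 (false ∷ T) p (s≤s (wt-≤ T))))
             (∑χ-support-1ⁿ σ (λ T → h (true ∷ T)) (λ T p → h≡0 (true ∷ T) (s≤s z≤n) (s≤s p))) ⟩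
  h 0ⁿ + sgn s * (χ σ 1ⁿ * h 1ⁿ)
    ≡⟨ cong (λ z → h 0ⁿ + z) (sym (ℤ.*-assoc (sgn s) (χ σ 1ⁿ) (h 1ⁿ))) ⟩
  h 0ⁿ + sgn s * χ σ 1ⁿ * h 1ⁿ
    ≡⟨ cong (λ c → h 0ⁿ + c * h 1ⁿ) (χ-∷true s σ 1ⁿ) ⟨
  h 0ⁿ + χ (s ∷ σ) 1ⁿ * h 1ⁿ ∎
  where open ≡-Reasoning

∑χ-support-wt≤1-1ⁿ : (σ : Z2^ (suc (suc k))) (h : Z2^ (suc (suc k)) → ℤ) →
  (∀ T → 2 ≤ wt T → wt T ℕ.< suc (suc k) → h T ≡ 0ℤ) →
  (∑[ T ] χ σ T * h T) ≡ h 0ⁿ + signedSum σ (unitValues h) + χ σ 1ⁿ * h 1ⁿ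
∑χ-support-wt≤1-1ⁿ (s ∷ σ) h h≡0 = begin
  (∑[ T ] χ (s ∷ σ) T * h T)
    ≡⟨ ∑χ-split s σ h ⟩
  (∑[ T ] χ σ T * h (false ∷ T)) + sgn s * (∑[ T ] χ σ T * h (true ∷ T))
    ≡⟨ cong₂ (λ u v → u + sgn s * v)
             (∑χ-support-wt≤1 σ (λ T → h (false ∷ T)) (λ T p → h≡0 (false ∷ T) p (s≤s (wt-≤ T))))
             (∑χ-support-0-1ⁿ σ (λ T → h (true ∷ T)) (λ T p q → h≡0 (true ∷ T) (s≤s p) (s≤s q))) ⟩
  (h 0ⁿ + L) + sgn s * (h (true ∷ 0ⁿ) + χ σ 1ⁿ * h 1ⁿ)
    ≡⟨ regroup (h 0ⁿ) L (sgn s) (h (true ∷ 0ⁿ)) (χ σ 1ⁿ) (h 1ⁿ) ⟩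
  h 0ⁿ + (sgn s * h (true ∷ 0ⁿ) + L) + sgn s * χ σ 1ⁿ * h 1ⁿ
    ≡⟨ cong (λ c → h 0ⁿ + (sgn s * h (true ∷ 0ⁿ) + L) + c * h 1ⁿ) (χ-∷true s σ 1ⁿ) ⟨
  h 0ⁿ + (sgn s * h (true ∷ 0ⁿ) + L) + χ (s ∷ σ) 1ⁿ * h 1ⁿ ∎
  where
  open ≡-Reasoning
  L = signedSum σ (unitValues (λ T → h (false ∷ T)))
  regroup : ∀ a b c d x y → (a + b) + c * (d + x * y) ≡ a + (c * d + b) + c * x * y
  regroup = solve-∀

-- Fibres of x ↦ (a₁ · x, …, aₖ · x)

coords : Vec (Z2^ n) k → Z2^ n → Z2^ k
coords as x = map (λ a → dot a x) as

χ-coords : (T : Z2^ k) (as : Vec (Z2^ n) k) (x : Z2^ n) → χ T (coords as x) ≡ χ (subsum T as) x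
χ-coords []          []       x = sym (χ-0ˡ x)
χ-coords (false ∷ T) (a ∷ as) x = χ-coords T as x
χ-coords (true ∷ T)  (a ∷ as) x = begin
  sgn (dot a x xor dot T (coords as x))  ≡⟨ sgn-xor (dot a x) _ ⟩
  χ a x * χ T (coords as x)              ≡⟨ cong (χ a x *_) (χ-coords T as x) ⟩
  χ a x * χ (subsum T as) x              ≡⟨ χ-⊕ˡ a (subsum T as) x ⟨
  χ (a ⊕ subsum T as) x                  ∎
  where open ≡-Reasoning

inFiber : Z2^ k → Vec (Z2^ n) k → Z2^ n → ℤ
inFiber σ as x = δ₀ (σ ⊕ coords as x)

inFiber-expansion : (σ : Z2^ k) (as : Vec (Z2^ n) k) (x : Z2^ n) →
  2^ k * inFiber σ as x ≡ (∑[ T ] χ σ T * χ (subsum T as) x)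
inFiber-expansion {k = k} σ as x = begin
  2^ k * δ₀ (σ ⊕ coords as x)             ≡⟨ ∑χ-dual (σ ⊕ coords as x) ⟨
  (∑[ T ] χ T (σ ⊕ coords as x))          ≡⟨ ∑-cong (λ T → χ-⊕ʳ T σ (coords as x)) ⟩
  (∑[ T ] χ T σ * χ T (coords as x))      ≡⟨ ∑-cong (λ T → cong₂ _*_ (χ-comm T σ) (χ-coords T as x)) ⟩
  (∑[ T ] χ σ T * χ (subsum T as) x)      ∎
  where open ≡-Reasoning

F̂-on-subsums : (h : Multiset n) (σ : Z2^ k) (as : Vec (Z2^ n) k) →
  (∑[ T ] χ σ T * F̂ h (subsum T as)) ≡ 2^ k * (∑[ x ] + h x * inFiber σ as x)
F̂-on-subsums {k = k} h σ as = begin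
  (∑[ T ] χ σ T * F̂ h (subsum T as))
    ≡⟨ ∑-cong (λ T → sym (∑-*ˡ (χ σ T) (λ x → + h x * χ (subsum T as) x))) ⟩
  (∑[ T ] ∑[ x ] χ σ T * (+ h x * χ (subsum T as) x))
    ≡⟨ ∑-comm (λ T x → χ σ T * (+ h x * χ (subsum T as) x)) ⟩
  (∑[ x ] ∑[ T ] χ σ T * (+ h x * χ (subsum T as) x))
    ≡⟨ ∑-cong (λ x → trans (∑-cong (λ T → *-leftSwap (χ σ T) (+ h x) _))
                           (∑-*ˡ (+ h x) (λ T → χ σ T * χ (subsum T as) x))) ⟩
  (∑[ x ] + h x * (∑[ T ] χ σ T * χ (subsum T as) x))
    ≡⟨ ∑-cong (λ x → cong (+ h x *_) (inFiber-expansion σ as x)) ⟨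
  (∑[ x ] + h x * (2^ k * inFiber σ as x))
    ≡⟨ ∑-cong (λ x → *-leftSwap (+ h x) (2^ k) (inFiber σ as x)) ⟩
  (∑[ x ] 2^ k * (+ h x * inFiber σ as x))
    ≡⟨ ∑-*ˡ (2^ k) (λ x → + h x * inFiber σ as x) ⟩
  2^ k * (∑[ x ] + h x * inFiber σ as x) ∎
  where open ≡-Reasoning

Independent : Vec (Z2^ n) k → Set
Independent {k = k} as = (T : Z2^ k) → 1 ≤ wt T → subsum T as ≢ 0ⁿ

δ₀≡0⇒1≤wt : (T : Z2^ k) → δ₀ T ≡ 0ℤ → 1 ≤ wt T
δ₀≡0⇒1≤wt []          ()
δ₀≡0⇒1≤wt (true ∷ T)  _  = s≤s z≤n
δ₀≡0⇒1≤wt (false ∷ T) e  = δ₀≡0⇒1≤wt T e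

δ₀-subsum : (as : Vec (Z2^ n) k) → Independent as → (T : Z2^ k) → δ₀ (subsum T as) ≡ δ₀ T
δ₀-subsum {n} {k} as indep T with δ₀≡0⊎≡0ⁿ T
... | inj₂ refl = trans (cong δ₀ (subsum-0ⁿ as)) (trans (δ₀-0ⁿ {n}) (sym (δ₀-0ⁿ {k})))
... | inj₁ δT≡0 with δ₀≡0⊎≡0ⁿ (subsum T as)
...   | inj₁ δΣ≡0 = trans δΣ≡0 (sym δT≡0)
...   | inj₂ Σ≡0  = ⊥-elim (indep T (δ₀≡0⇒1≤wt T δT≡0) Σ≡0)

∑-inFiber : (σ : Z2^ n) (as : Vec (Z2^ n) n) → Independent as → (∑[ x ] inFiber σ as x) ≡ 1ℤ
∑-inFiber {n} σ as indep = *-cancelˡ-≢0 (2^ n) (2^≢0 n) (begin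
  2^ n * (∑[ x ] inFiber σ as x)
    ≡⟨ ∑-*ˡ (2^ n) (inFiber σ as) ⟨
  (∑[ x ] 2^ n * inFiber σ as x)
    ≡⟨ ∑-cong (inFiber-expansion σ as) ⟩
  (∑[ x ] ∑[ T ] χ σ T * χ (subsum T as) x)
    ≡⟨ ∑-comm (λ x T → χ σ T * χ (subsum T as) x) ⟩
  (∑[ T ] ∑[ x ] χ σ T * χ (subsum T as) x)
    ≡⟨ ∑-cong (λ T → trans (∑-*ˡ (χ σ T) (χ (subsum T as))) (cong (χ σ T *_) (∑χ (subsum T as)))) ⟩
  (∑[ T ] χ σ T * (2^ n * δ₀ (subsum T as)))
    ≡⟨ ∑-cong (λ T → trans (cong (λ d → χ σ T * (2^ n * d)) (δ₀-subsum as indep T))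
                           (*-leftSwap (χ σ T) (2^ n) (δ₀ T))) ⟩
  (∑[ T ] 2^ n * (χ σ T * δ₀ T))
    ≡⟨ ∑-*ˡ (2^ n) (λ T → χ σ T * δ₀ T) ⟩
  2^ n * (∑[ T ] χ σ T * δ₀ T)
    ≡⟨ cong (λ z → 2^ n * z) (trans (∑-cong (λ T → cong (λ y → χ σ T * δ₀ y) (sym (⊕-identityʳ T))))
                                    (trans (∑-δ₀ (χ σ) 0ⁿ) (χ-0ʳ σ))) ⟩
  2^ n * 1ℤ ∎)
  where open ≡-Reasoning

δ₀-0-or-1 : (x : Z2^ n) → δ₀ x ≡ 0ℤ ⊎ δ₀ x ≡ 1ℤ
δ₀-0-or-1 []          = inj₂ refl
δ₀-0-or-1 (true ∷ x)  = inj₁ refl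
δ₀-0-or-1 (false ∷ x) = δ₀-0-or-1 x

∑-indicator-bounds : ∀ {B} (h : Multiset n) (w : Z2^ n → ℤ) →
  (∀ x → w x ≡ 0ℤ ⊎ w x ≡ 1ℤ) → ∑ w ≡ 1ℤ → (∀ x → h x ≤ B) →
  0ℤ ℤ.≤ (∑[ x ] + h x * w x) × (∑[ x ] + h x * w x) ℤ.≤ + B
∑-indicator-bounds {n} {B} h w w01 ∑w≡1 h≤B =
  subst (ℤ._≤ (∑[ x ] + h x * w x)) (∑-zero {n} (λ _ → 0ℤ) (λ _ → refl)) (∑-mono-≤ lower) ,
  subst ((∑[ x ] + h x * w x) ℤ.≤_) (trans (∑-*ˡ (+ B) w) (trans (cong (+ B *_) ∑w≡1) (ℤ.*-identityʳ (+ B))))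
        (∑-mono-≤ upper)
  where
  lower : ∀ x → 0ℤ ℤ.≤ + h x * w x
  lower x with w01 x
  ... | inj₁ e rewrite e | ℤ.*-zeroʳ (+ h x)     = ℤ.+≤+ z≤n
  ... | inj₂ e rewrite e | ℤ.*-identityʳ (+ h x) = ℤ.+≤+ z≤n
  upper : ∀ x → + h x * w x ℤ.≤ + B * w x
  upper x with w01 x
  ... | inj₁ e rewrite e | ℤ.*-zeroʳ (+ h x) | ℤ.*-zeroʳ (+ B)         = ℤ.+≤+ z≤n
  ... | inj₂ e rewrite e | ℤ.*-identityʳ (+ h x) | ℤ.*-identityʳ (+ B) = ℤ.+≤+ (h≤B x)

-- Signed sums

twist : Z2^ k → Vec ℤ k → Vec ℤ k
twist = zipWith (λ e b → sgn e * b)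

equal-squares⇒≡± : ∀ (x y : ℤ) → x * x ≡ y * y → x ≡ y ⊎ x ≡ - y
equal-squares⇒≡± x y x²≡y² with ℤ.i*j≡0⇒i≡0∨j≡0 (x - y) (trans (difference-of-squares x y) x²-y²≡0)
  where
  difference-of-squares : ∀ x y → (x - y) * (x + y) ≡ x * x - y * y
  difference-of-squares = solve-∀
  x²-y²≡0 : x * x - y * y ≡ 0ℤ
  x²-y²≡0 = trans (cong (_- y * y) x²≡y²) (ℤ.+-inverseʳ (y * y))
... | inj₁ x-y≡0 = inj₁ (ℤ.i-j≡0⇒i≡j x y x-y≡0)
... | inj₂ x+y≡0 = inj₂ (trans (add-sub x y) (trans (cong (_- y) x+y≡0) (ℤ.+-identityˡ (- y))))
  where
  add-sub : ∀ x y → x ≡ (x + y) - y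
  add-sub = solve-∀

x*x≡0⇒x≡0 : ∀ x → x * x ≡ 0ℤ → x ≡ 0ℤ
x*x≡0⇒x≡0 x x²≡0 with ℤ.i*j≡0⇒i≡0∨j≡0 x x²≡0
... | inj₁ x≡0 = x≡0
... | inj₂ x≡0 = x≡0

twist-of-equal-squares : {A : Set} (u v : A → ℤ) → (∀ x → v x * v x ≡ u x * u x) →
  (xs : Vec A k) → Σ (Z2^ k) (λ ε → map v xs ≡ twist ε (map u xs))
twist-of-equal-squares u v sq []       = [] , refl
twist-of-equal-squares u v sq (x ∷ xs) with twist-of-equal-squares u v sq xs
... | ε , vs≡ with equal-squares⇒≡± (v x) (u x) (sq x)
...   | inj₁ vx≡ux  = false ∷ ε , cong₂ _∷_ (trans vx≡ux (sym (ℤ.*-identityˡ (u x)))) vs≡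
...   | inj₂ vx≡-ux = true ∷ ε , cong₂ _∷_ (trans vx≡-ux (sym (ℤ.-1*i≡-i (u x)))) vs≡

signedSum-twist : (σ ε : Z2^ k) (bs : Vec ℤ k) → signedSum σ (twist ε bs) ≡ signedSum (σ ⊕ ε) bs
signedSum-twist []      []      []       = refl
signedSum-twist (s ∷ σ) (e ∷ ε) (b ∷ bs) = cong₂ _+_
  (trans (sym (ℤ.*-assoc (sgn s) (sgn e) b)) (cong (_* b) (sym (sgn-xor s e))))
  (signedSum-twist σ ε bs)

∏-twist : (ε : Z2^ k) (bs : Vec ℤ k) → (∏[ b ∈ twist ε bs ] b) ≡ χ ε 1ⁿ * (∏[ b ∈ bs ] b)
∏-twist []      []       = sym (ℤ.*-identityˡ 1ℤ)
∏-twist (e ∷ ε) (b ∷ bs) = begin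
  (sgn e * b) * (∏[ b ∈ twist ε bs ] b)         ≡⟨ cong (sgn e * b *_) (∏-twist ε bs) ⟩
  (sgn e * b) * (χ ε 1ⁿ * (∏[ b ∈ bs ] b))      ≡⟨ *-interchange (sgn e) b (χ ε 1ⁿ) _ ⟩
  (sgn e * χ ε 1ⁿ) * (b * (∏[ b ∈ bs ] b))      ≡⟨ cong (_* (b * (∏[ b ∈ bs ] b))) (χ-∷true e ε 1ⁿ) ⟨
  χ (e ∷ ε) 1ⁿ * (b * (∏[ b ∈ bs ] b))          ∎
  where open ≡-Reasoning

signedSum-not : (σ : Z2^ k) (bs : Vec ℤ k) → signedSum (map not σ) bs ≡ - signedSum σ bs
signedSum-not []      []       = refl
signedSum-not (s ∷ σ) (b ∷ bs) rewrite sgn-not s | signedSum-not σ bs =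
  trans (cong (_+ - signedSum σ bs) (sym (ℤ.neg-distribˡ-* (sgn s) b)))
        (sym (ℤ.neg-distrib-+ (sgn s * b) (signedSum σ bs)))

isNeg : ℤ → Bool
isNeg (+ _)      = false
isNeg ℤ.-[1+ _ ] = true

signsOf : Vec ℤ k → Z2^ k
signsOf = map isNeg

ℓ¹ : Vec ℤ k → ℕ
ℓ¹ bs = V.sum (map ∣_∣ bs)

signedSum-signsOf : (bs : Vec ℤ k) → signedSum (signsOf bs) bs ≡ + ℓ¹ bs
signedSum-signsOf []       = refl
signedSum-signsOf (b ∷ bs) =
  trans (cong₂ _+_ (sgn-isNeg b) (signedSum-signsOf bs)) (sym (ℤ.pos-+ ∣ b ∣ (ℓ¹ bs)))
  where
  sgn-isNeg : ∀ b → sgn (isNeg b) * b ≡ + ∣ b ∣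
  sgn-isNeg (+ m)      = ℤ.*-identityˡ (+ m)
  sgn-isNeg ℤ.-[1+ m ] = ℤ.-1*i≡-i ℤ.-[1+ m ]

signedSum-differences-divisible : ∀ d (bs : Vec ℤ k) →
  (∀ σ σ′ → d ∣ signedSum σ bs - signedSum σ′ bs) → All (λ b → d ∣ b + b) bs
signedSum-differences-divisible d []       _  = []
signedSum-differences-divisible d (b ∷ bs) d∣ =
  subst (d ∣_) (flip-head b (signedSum 0ⁿ bs)) (d∣ (false ∷ 0ⁿ) (true ∷ 0ⁿ)) ∷
  signedSum-differences-divisible d bs
    (λ σ σ′ → subst (d ∣_) (same-head b (signedSum σ bs) (signedSum σ′ bs)) (d∣ (false ∷ σ) (false ∷ σ′)))
  where
  flip-head : ∀ b L → (1ℤ * b + L) - (-1ℤ * b + L) ≡ b + b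
  flip-head = solve-∀
  same-head : ∀ b L L′ → (1ℤ * b + L) - (1ℤ * b + L′) ≡ L - L′
  same-head = solve-∀

∣i+i∣ : ∀ i → ∣ i + i ∣ ≡ ∣ i ∣ ℕ.+ ∣ i ∣
∣i+i∣ i = trans (cong ∣_∣ (double i)) (trans (ℤ.abs-* (+ 2) i) (cong (∣ i ∣ ℕ.+_) (ℕ.+-identityʳ ∣ i ∣)))
  where
  double : ∀ i → i + i ≡ + 2 * i
  double = solve-∀

∣d∣≤∣b∣+∣b∣ : ∀ {d} b → d ∣ b + b → b ≢ 0ℤ → ∣ d ∣ ≤ ∣ b ∣ ℕ.+ ∣ b ∣
∣d∣≤∣b∣+∣b∣ b d∣b+b b≢0 =
  ∣⇒≤ {{ℕ.≢-nonZero (λ e → b≢0 (ℤ.∣i∣≡0⇒i≡0 (ℕ.m+n≡0⇒m≡0 ∣ b ∣ e)))}}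
        (subst (_ ℕ∣_) (∣i+i∣ b) (∣⇒∣ᵤ d∣b+b))

ℓ¹-lower-bound : ∀ d (bs : Vec ℤ k) → All (λ b → d ∣ b + b) bs → All (_≢ 0ℤ) bs →
  k ℕ.* ∣ d ∣ ≤ ℓ¹ bs ℕ.+ ℓ¹ bs
ℓ¹-lower-bound d []       []          []           = z≤n
ℓ¹-lower-bound {suc k} d (b ∷ bs) (d∣ ∷ d∣s) (b≢0 ∷ bs≢0) =
  subst (suc k ℕ.* ∣ d ∣ ≤_) (ℕ-+-interchange ∣ b ∣ ∣ b ∣ (ℓ¹ bs) (ℓ¹ bs))
    (ℕ.+-mono-≤ (∣d∣≤∣b∣+∣b∣ b d∣ b≢0) (ℓ¹-lower-bound d bs d∣s bs≢0))

∏≢0⇒All≢0 : (bs : Vec ℤ k) → (∏[ b ∈ bs ] b) ≢ 0ℤ → All (_≢ 0ℤ) bs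
∏≢0⇒All≢0 []       _   = []
∏≢0⇒All≢0 (b ∷ bs) ∏≢0 =
  (λ b≡0 → ∏≢0 (trans (cong (_* (∏[ b ∈ bs ] b)) b≡0) (ℤ.*-zeroˡ (∏[ b ∈ bs ] b)))) ∷
  ∏≢0⇒All≢0 bs (λ ∏bs≡0 → ∏≢0 (trans (cong (b *_) ∏bs≡0) (ℤ.*-zeroʳ b)))

i+i≡0⇒i≡0 : ∀ i → i + i ≡ 0ℤ → i ≡ 0ℤ
i+i≡0⇒i≡0 i i+i≡0 with ℤ.i*j≡0⇒i≡0∨j≡0 (+ 2) (trans (double i) i+i≡0)
  where
  double : ∀ i → + 2 * i ≡ i + i
  double = solve-∀
... | inj₁ ()
... | inj₂ i≡0 = i≡0

record Scaled (m B : ℕ) (v : ℤ) : Set where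
  constructor scaled
  field
    u     : ℤ
    0≤u   : 0ℤ ℤ.≤ u
    u≤B   : u ℤ.≤ + B
    2^m*u : 2^ m * u ≡ v

Scaled⇒∣ : ∀ {m B v} → Scaled m B v → 2^ m ∣ v
Scaled⇒∣ {m} (scaled u _ _ 2^m*u≡v) = divides u (trans (sym 2^m*u≡v) (ℤ.*-comm (2^ m) u))

Scaled⇒0≤ : ∀ {m B v} → Scaled m B v → 0ℤ ℤ.≤ v
Scaled⇒0≤ {m} (scaled u 0≤u _ 2^m*u≡v) =
  subst₂ ℤ._≤_ (ℤ.*-zeroʳ (2^ m)) 2^m*u≡v (ℤ.*-monoˡ-≤-nonNeg (2^ m) 0≤u)

Scaled⇒≤ : ∀ {m B v} → Scaled m B v → v ℤ.≤ 2^ m * + B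
Scaled⇒≤ {m} (scaled u _ u≤B 2^m*u≡v) = subst (ℤ._≤ _) 2^m*u≡v (ℤ.*-monoˡ-≤-nonNeg (2^ m) u≤B)

squeeze : ∀ N A D M → M ℤ.≤ A + A →
  N + A + D ℤ.≤ M → N + A - D ℤ.≤ M → 0ℤ ℤ.≤ N - A + D → 0ℤ ℤ.≤ N - A - D → D ≡ 0ℤ
squeeze N A D M M≤2A h₁ h₂ h₃ h₄ = i+i≡0⇒i≡0 D (ℤ.≤-antisym D+D≤0 0≤D+D)
  where
  0≤-[D+D] : 0ℤ ℤ.≤ - (D + D)
  0≤-[D+D] = subst (0ℤ ℤ.≤_) (sum₁ N A D M)
    (ℤ.+-mono-≤ (ℤ.+-mono-≤ (ℤ.i≤j⇒0≤j-i h₁) h₄) (ℤ.i≤j⇒0≤j-i M≤2A))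
    where
    sum₁ : ∀ N A D M → (M - (N + A + D)) + (N - A - D) + ((A + A) - M) ≡ - (D + D)
    sum₁ = solve-∀
  0≤D+D : 0ℤ ℤ.≤ D + D
  0≤D+D = subst (0ℤ ℤ.≤_) (sum₂ N A D M)
    (ℤ.+-mono-≤ (ℤ.+-mono-≤ (ℤ.i≤j⇒0≤j-i h₂) h₃) (ℤ.i≤j⇒0≤j-i M≤2A))
    where
    sum₂ : ∀ N A D M → (M - (N + A - D)) + (N - A + D) + ((A + A) - M) ≡ D + D
    sum₂ = solve-∀
  D+D≤0 : D + D ℤ.≤ 0ℤ
  D+D≤0 = subst (ℤ._≤ 0ℤ) (ℤ.neg-involutive (D + D)) (ℤ.neg-mono-≤ 0≤-[D+D])

-- The top-degree deck

module _ {n′ : ℕ} (f g : Multiset (suc (suc n′)))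
         (agree : ∀ i → i ≤ suc (suc n′) → ZeroSumProductsAgree i f g) where

  private
    dim : ℕ
    dim = suc (suc n′)

  F̂²-agree : (y : Z2^ dim) → F̂ f y * F̂ f y ≡ F̂ g y * F̂ g y
  F̂²-agree y = begin
    F̂ f y * F̂ f y           ≡⟨ cong (F̂ f y *_) (ℤ.*-identityʳ (F̂ f y)) ⟨
    ∏F̂ f (y ∷ y ∷ [])       ≡⟨ agree 2 (s≤s (s≤s z≤n)) (y ∷ y ∷ [])
                                 (trans (cong (y ⊕_) (⊕-identityʳ y)) (⊕-self y)) ⟩
    ∏F̂ g (y ∷ y ∷ [])       ≡⟨ cong (F̂ g y *_) (ℤ.*-identityʳ (F̂ g y)) ⟩
    F̂ g y * F̂ g y           ∎
    where open ≡-Reasoning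

  F̂-agree-at-0ⁿ : F̂ f 0ⁿ ≡ F̂ g 0ⁿ
  F̂-agree-at-0ⁿ = trans (sym (ℤ.*-identityʳ (F̂ f 0ⁿ)))
    (trans (agree 1 (s≤s z≤n) (0ⁿ ∷ []) (⊕-identityʳ 0ⁿ)) (ℤ.*-identityʳ (F̂ g 0ⁿ)))

  agree-if-subsum-vanishes : (as : Vec (Z2^ dim) dim) (T : Z2^ dim) → 1 ≤ wt T → subsum T as ≡ 0ⁿ →
    ∏F̂ f (vsum as ∷ as) ≡ ∏F̂ g (vsum as ∷ as)
  agree-if-subsum-vanishes as T 1≤wt ΣT≡0 = begin
    ∏F̂ f (vsum as ∷ as)                                     ≡⟨ ∏F̂-split f (vsum as) T as ⟩
    ∏F̂ f (sel T as) * ∏F̂ f (vsum as ∷ sel (map not T) as)   ≡⟨ cong₂ _*_ agree-on-T agree-on-rest ⟩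
    ∏F̂ g (sel T as) * ∏F̂ g (vsum as ∷ sel (map not T) as)   ≡⟨ ∏F̂-split g (vsum as) T as ⟨
    ∏F̂ g (vsum as ∷ as)                                     ∎
    where
    open ≡-Reasoning
    Σas≡ΣTᶜ : vsum as ≡ subsum (map not T) as
    Σas≡ΣTᶜ = trans (sym (subsum-split T as))
                    (trans (cong (_⊕ subsum (map not T) as) ΣT≡0) (⊕-identityˡ _))
    agree-on-T = agree (wt T) (wt-≤ T) (sel T as) ΣT≡0
    agree-on-rest = agree (suc (wt (map not T))) (wt-not-bound T 1≤wt)
                          (vsum as ∷ sel (map not T) as) (≡⇒⊕≡0 Σas≡ΣTᶜ)

  agree-if-F̂-nonzero : (as : Vec (Z2^ dim) dim) (T : Z2^ dim) → 2 ≤ wt T → wt T ℕ.< dim →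
    F̂ f (subsum T as) ≢ 0ℤ → ∏F̂ f (vsum as ∷ as) ≡ ∏F̂ g (vsum as ∷ as)
  agree-if-F̂-nonzero as T 2≤wt wt<dim F̂y≢0 =
    *-cancelˡ-≢0 (F̂ f y * F̂ f y) (F̂y≢0 ∘ x*x≡0⇒x≡0 (F̂ f y)) (begin
      (F̂ f y * F̂ f y) * ∏F̂ f (vsum as ∷ as)
        ≡⟨ ∏F̂-split-twice f y (vsum as) T as ⟩
      ∏F̂ f (y ∷ sel T as) * ∏F̂ f (y ∷ vsum as ∷ sel (map not T) as)
        ≡⟨ cong₂ _*_ (agree (suc (wt T)) wt<dim (y ∷ sel T as) (⊕-self y))
                     (agree (2 ℕ.+ wt (map not T)) (wt-not-bound T 2≤wt)
                            (y ∷ vsum as ∷ sel (map not T) as) (≡⇒⊕≡0 (sym Σas⊕z≡y))) ⟩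
      ∏F̂ g (y ∷ sel T as) * ∏F̂ g (y ∷ vsum as ∷ sel (map not T) as)
        ≡⟨ ∏F̂-split-twice g y (vsum as) T as ⟨
      (F̂ g y * F̂ g y) * ∏F̂ g (vsum as ∷ as)
        ≡⟨ cong (_* ∏F̂ g (vsum as ∷ as)) (F̂²-agree y) ⟨
      (F̂ f y * F̂ f y) * ∏F̂ g (vsum as ∷ as) ∎)
    where
    open ≡-Reasoning
    y z : Z2^ dim
    y = subsum T as
    z = subsum (map not T) as
    Σas⊕z≡y : vsum as ⊕ z ≡ y
    Σas⊕z≡y = trans (cong (_⊕ z) (sym (subsum-split T as))) (⊕-cancelʳ y z)

  module Counterexample (f≤dim : ∀ x → f x ≤ dim) (g≤dim : ∀ x → g x ≤ dim)
                        (as : Vec (Z2^ dim) dim)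
                        (differ : ∏F̂ f (vsum as ∷ as) ≢ ∏F̂ g (vsum as ∷ as)) where

    private
      P P′ D D′ N₀ : ℤ
      P  = ∏F̂ f (vsum as ∷ as)
      P′ = ∏F̂ g (vsum as ∷ as)
      D  = F̂ f (vsum as)
      D′ = F̂ g (vsum as)
      N₀ = F̂ f 0ⁿ

      bs : Vec ℤ dim
      bs = map (F̂ f) as

      L : Z2^ dim → ℤ
      L σ = signedSum σ bs

    P²≡P′² : P * P ≡ P′ * P′
    P²≡P′² = ∏-squares (F̂ f) (F̂ g) F̂²-agree (vsum as ∷ as)

    P≢0 : P ≢ 0ℤ
    P≢0 P≡0 = differ (trans P≡0 (sym (x*x≡0⇒x≡0 P′ (trans (sym P²≡P′²)
                                 (trans (cong (_* P) P≡0) (ℤ.*-zeroˡ P))))))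

    P′≡-P : P′ ≡ - P
    P′≡-P = [ (λ P′≡P → ⊥-elim (differ (sym P′≡P))) , id ]′ (equal-squares⇒≡± P′ P (sym P²≡P′²))

    D≢0 : D ≢ 0ℤ
    D≢0 D≡0 = P≢0 (trans (cong (_* ∏F̂ f as) D≡0) (ℤ.*-zeroˡ (∏F̂ f as)))

    ∏F̂as≢0 : ∏F̂ f as ≢ 0ℤ
    ∏F̂as≢0 ∏≡0 = P≢0 (trans (cong (D *_) ∏≡0) (ℤ.*-zeroʳ D))

    independent : Independent as
    independent T 1≤wt ΣT≡0 = differ (agree-if-subsum-vanishes as T 1≤wt ΣT≡0)

    F̂f-vanishes : ∀ T → 2 ≤ wt T → wt T ℕ.< dim → F̂ f (subsum T as) ≡ 0ℤ
    F̂f-vanishes T 2≤wt wt<dim = decidable-stable (F̂ f (subsum T as) ℤ.≟ 0ℤ)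
      (λ F̂≢0 → differ (agree-if-F̂-nonzero as T 2≤wt wt<dim F̂≢0))

    F̂g-vanishes : ∀ T → 2 ≤ wt T → wt T ℕ.< dim → F̂ g (subsum T as) ≡ 0ℤ
    F̂g-vanishes T 2≤wt wt<dim = x*x≡0⇒x≡0 (F̂ g (subsum T as))
      (trans (sym (F̂²-agree (subsum T as)))
             (cong (λ v → v * v) (F̂f-vanishes T 2≤wt wt<dim)))

    U : Multiset dim → Z2^ dim → ℤ
    U h σ = ∑[ x ] + h x * inFiber σ as x

    2^dim*U : (h : Multiset dim) → (∀ T → 2 ≤ wt T → wt T ℕ.< dim → F̂ h (subsum T as) ≡ 0ℤ) →
      ∀ σ → 2^ dim * U h σ ≡ F̂ h 0ⁿ + signedSum σ (map (F̂ h) as) + χ σ 1ⁿ * F̂ h (vsum as)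
    2^dim*U h vanishes σ = begin
      2^ dim * U h σ
        ≡⟨ F̂-on-subsums h σ as ⟨
      (∑[ T ] χ σ T * F̂ h (subsum T as))
        ≡⟨ ∑χ-support-wt≤1-1ⁿ σ (λ T → F̂ h (subsum T as)) vanishes ⟩
      F̂ h (subsum 0ⁿ as) + signedSum σ (unitValues (λ T → F̂ h (subsum T as)))
        + χ σ 1ⁿ * F̂ h (subsum 1ⁿ as)
        ≡⟨ cong₂ (λ u v → F̂ h u + signedSum σ v + χ σ 1ⁿ * F̂ h (subsum 1ⁿ as))
                 (subsum-0ⁿ as) (unitValues-subsum (F̂ h) as) ⟩
      F̂ h 0ⁿ + signedSum σ (map (F̂ h) as) + χ σ 1ⁿ * F̂ h (subsum 1ⁿ as)
        ≡⟨ cong (λ u → F̂ h 0ⁿ + signedSum σ (map (F̂ h) as) + χ σ 1ⁿ * F̂ h u) (subsum-1ⁿ as) ⟩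
      F̂ h 0ⁿ + signedSum σ (map (F̂ h) as) + χ σ 1ⁿ * F̂ h (vsum as) ∎
      where open ≡-Reasoning

    private
      ε : Z2^ dim
      ε = proj₁ (twist-of-equal-squares (F̂ f) (F̂ g) (λ y → sym (F̂²-agree y)) as)

      F̂g-as-twist : map (F̂ g) as ≡ twist ε bs
      F̂g-as-twist = proj₂ (twist-of-equal-squares (F̂ f) (F̂ g) (λ y → sym (F̂²-agree y)) as)

    ∏F̂g≡χε*∏F̂f : ∏F̂ g as ≡ χ ε 1ⁿ * ∏F̂ f as
    ∏F̂g≡χε*∏F̂f = begin
      ∏F̂ g as                        ≡⟨ ∏-map (F̂ g) as ⟨
      (∏[ b ∈ map (F̂ g) as ] b)      ≡⟨ cong (λ bs′ → ∏[ b ∈ bs′ ] b) F̂g-as-twist ⟩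
      (∏[ b ∈ twist ε bs ] b)        ≡⟨ ∏-twist ε bs ⟩
      χ ε 1ⁿ * (∏[ b ∈ bs ] b)       ≡⟨ cong (χ ε 1ⁿ *_) (∏-map (F̂ f) as) ⟩
      χ ε 1ⁿ * ∏F̂ f as               ∎
      where open ≡-Reasoning

    χε*D′≡-D : χ ε 1ⁿ * D′ ≡ - D
    χε*D′≡-D = ℤ.*-cancelʳ-≡ (χ ε 1ⁿ * D′) (- D) (∏F̂ f as) {{ℤ.≢-nonZero ∏F̂as≢0}} (begin
      (χ ε 1ⁿ * D′) * ∏F̂ f as    ≡⟨ cong (_* ∏F̂ f as) (ℤ.*-comm (χ ε 1ⁿ) D′) ⟩
      (D′ * χ ε 1ⁿ) * ∏F̂ f as    ≡⟨ ℤ.*-assoc D′ (χ ε 1ⁿ) (∏F̂ f as) ⟩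
      D′ * (χ ε 1ⁿ * ∏F̂ f as)    ≡⟨ cong (D′ *_) ∏F̂g≡χε*∏F̂f ⟨
      P′                         ≡⟨ P′≡-P ⟩
      - (D * ∏F̂ f as)            ≡⟨ ℤ.neg-distribˡ-* D (∏F̂ f as) ⟩
      (- D) * ∏F̂ f as            ∎)
      where open ≡-Reasoning

    2^dim*Uf : ∀ σ → 2^ dim * U f σ ≡ N₀ + L σ + χ σ 1ⁿ * D
    2^dim*Uf = 2^dim*U f F̂f-vanishes

    2^dim*Ug-twisted : ∀ σ → 2^ dim * U g (σ ⊕ ε) ≡ N₀ + L σ - χ σ 1ⁿ * D
    2^dim*Ug-twisted σ = begin
      2^ dim * U g (σ ⊕ ε)
        ≡⟨ 2^dim*U g F̂g-vanishes (σ ⊕ ε) ⟩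
      F̂ g 0ⁿ + signedSum (σ ⊕ ε) (map (F̂ g) as) + χ (σ ⊕ ε) 1ⁿ * D′
        ≡⟨ cong₂ _+_ (cong₂ _+_ (sym F̂-agree-at-0ⁿ) signedSum-untwisted) flipped-top ⟩
      N₀ + L σ - χ σ 1ⁿ * D ∎
      where
      open ≡-Reasoning
      signedSum-untwisted : signedSum (σ ⊕ ε) (map (F̂ g) as) ≡ L σ
      signedSum-untwisted = begin
        signedSum (σ ⊕ ε) (map (F̂ g) as)   ≡⟨ cong (signedSum (σ ⊕ ε)) F̂g-as-twist ⟩
        signedSum (σ ⊕ ε) (twist ε bs)     ≡⟨ signedSum-twist (σ ⊕ ε) ε bs ⟩
        signedSum ((σ ⊕ ε) ⊕ ε) bs         ≡⟨ cong (λ τ → signedSum τ bs) (⊕-cancelʳ σ ε) ⟩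
        L σ                                ∎
      flipped-top : χ (σ ⊕ ε) 1ⁿ * D′ ≡ - (χ σ 1ⁿ * D)
      flipped-top = begin
        χ (σ ⊕ ε) 1ⁿ * D′           ≡⟨ cong (_* D′) (χ-⊕ˡ σ ε 1ⁿ) ⟩
        (χ σ 1ⁿ * χ ε 1ⁿ) * D′      ≡⟨ ℤ.*-assoc (χ σ 1ⁿ) (χ ε 1ⁿ) D′ ⟩
        χ σ 1ⁿ * (χ ε 1ⁿ * D′)      ≡⟨ cong (χ σ 1ⁿ *_) χε*D′≡-D ⟩
        χ σ 1ⁿ * - D                ≡⟨ ℤ.neg-distribʳ-* (χ σ 1ⁿ) D ⟨
        - (χ σ 1ⁿ * D)              ∎

    U-scaled : (h : Multiset dim) → (∀ x → h x ≤ dim) → ∀ σ → Scaled dim dim (2^ dim * U h σ)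
    U-scaled h h≤dim σ =
      let 0≤U , U≤dim = ∑-indicator-bounds h (inFiber σ as) (λ x → δ₀-0-or-1 (σ ⊕ coords as x))
                                           (∑-inFiber σ as independent) h≤dim
      in scaled (U h σ) 0≤U U≤dim refl

    scaled-with-sign : ∀ σ c → χ σ 1ⁿ ≡ c →
      Scaled dim dim (N₀ + L σ + c * D) × Scaled dim dim (N₀ + L σ - c * D)
    scaled-with-sign σ c χ≡c =
      subst (Scaled dim dim) (trans (2^dim*Uf σ) (cong (λ e → N₀ + L σ + e * D) χ≡c))
            (U-scaled f f≤dim σ) ,
      subst (Scaled dim dim) (trans (2^dim*Ug-twisted σ) (cong (λ e → N₀ + L σ - e * D) χ≡c))
            (U-scaled g g≤dim (σ ⊕ ε))

    scaled-both-signs : ∀ σ → Scaled dim dim (N₀ + L σ + D) × Scaled dim dim (N₀ + L σ - D)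
    scaled-both-signs σ = [ positive , negative ]′ (sgn-1-or-−1 (dot σ 1ⁿ))
      where
      positive : χ σ 1ⁿ ≡ 1ℤ → Scaled dim dim (N₀ + L σ + D) × Scaled dim dim (N₀ + L σ - D)
      positive χ≡1 = Product.map (subst (λ e → Scaled dim dim (N₀ + L σ + e)) (ℤ.*-identityˡ D))
                                 (subst (λ e → Scaled dim dim (N₀ + L σ - e)) (ℤ.*-identityˡ D))
                                 (scaled-with-sign σ 1ℤ χ≡1)
      negative : χ σ 1ⁿ ≡ -1ℤ → Scaled dim dim (N₀ + L σ + D) × Scaled dim dim (N₀ + L σ - D)
      negative χ≡-1 = Product.map
        (subst (λ e → Scaled dim dim (N₀ + L σ + e)) (trans (cong -_ (ℤ.-1*i≡-i D)) (ℤ.neg-involutive D)))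
        (subst (λ e → Scaled dim dim (N₀ + L σ + e)) (ℤ.-1*i≡-i D))
        (Product.swap (scaled-with-sign σ -1ℤ χ≡-1))

    2^dim∣L-differences : ∀ σ σ′ → 2^ dim ∣ L σ - L σ′
    2^dim∣L-differences σ σ′ = subst (2^ dim ∣_) (cancel N₀ D (L σ) (L σ′))
      (∣m∣n⇒∣m-n (Scaled⇒∣ (proj₁ (scaled-both-signs σ))) (Scaled⇒∣ (proj₁ (scaled-both-signs σ′))))
      where
      cancel : ∀ N D L L′ → (N + L + D) - (N + L′ + D) ≡ L - L′
      cancel = solve-∀

    private
      A : ℕ
      A = ℓ¹ bs

      M : ℤ
      M = 2^ dim * + dim

    M≤A+A : M ℤ.≤ + A + + A
    M≤A+A = subst₂ ℤ._≤_ (trans (cong +_ (ℕ.*-comm dim (2 ℕ.^ dim))) (ℤ.pos-* (2 ℕ.^ dim) dim))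
                        (ℤ.pos-+ A A)
                        (ℤ.+≤+ (ℓ¹-lower-bound (2^ dim) bs
                                  (signedSum-differences-divisible (2^ dim) bs 2^dim∣L-differences)
                                  (∏≢0⇒All≢0 bs (λ ∏≡0 → ∏F̂as≢0 (trans (sym (∏-map (F̂ f) as)) ∏≡0)))))

    D≡0 : D ≡ 0ℤ
    D≡0 = squeeze N₀ (+ A) D M M≤A+A
      (Scaled⇒≤ (proj₁ at-σ₊)) (Scaled⇒≤ (proj₂ at-σ₊)) (Scaled⇒0≤ (proj₁ at-σ₋)) (Scaled⇒0≤ (proj₂ at-σ₋))
      where
      σ₊ : Z2^ dim
      σ₊ = signsOf bs
      L-σ₊ : L σ₊ ≡ + A
      L-σ₊ = signedSum-signsOf bs
      L-σ₋ : L (map not σ₊) ≡ - + A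
      L-σ₋ = trans (signedSum-not σ₊ bs) (cong -_ L-σ₊)
      at-σ₊ : Scaled dim dim (N₀ + + A + D) × Scaled dim dim (N₀ + + A - D)
      at-σ₊ = subst (λ l → Scaled dim dim (N₀ + l + D) × Scaled dim dim (N₀ + l - D)) L-σ₊
                    (scaled-both-signs σ₊)
      at-σ₋ : Scaled dim dim (N₀ - + A + D) × Scaled dim dim (N₀ - + A - D)
      at-σ₋ = subst (λ l → Scaled dim dim (N₀ + l + D) × Scaled dim dim (N₀ + l - D)) L-σ₋
                    (scaled-both-signs (map not σ₊))

    absurd : ⊥
    absurd = D≢0 D≡0

products-agree-from-dim-2 : ∀ {n′} (f g : Multiset (suc (suc n′))) →
  (∀ x → f x ≤ suc (suc n′)) → (∀ x → g x ≤ suc (suc n′)) →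
  (∀ i → i ≤ suc (suc n′) → ZeroSumProductsAgree i f g) → ZeroSumProductsAgree (suc (suc (suc n′))) f g
products-agree-from-dim-2 f g f≤ g≤ agree (c ∷ as) c⊕Σas≡0 =
  subst (λ c → ∏F̂ f (c ∷ as) ≡ ∏F̂ g (c ∷ as)) (sym (⊕≡0⇒≡ c (vsum as) c⊕Σas≡0))
    (decidable-stable (∏F̂ f (vsum as ∷ as) ℤ.≟ ∏F̂ g (vsum as ∷ as))
                      (Counterexample.absurd f g agree f≤ g≤ as))

-- The left-hand side is the normal form of F̂ h 1ⁿ * F̂ h 1ⁿ on Z₂¹.
square-of-difference : ∀ {u v} → u ≤ 1 → v ≤ 1 →
  (+ u * 1ℤ + + v * -1ℤ) * (+ u * 1ℤ + + v * -1ℤ) ≡ + ((u ℕ.+ v) ℕ.% 2)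
square-of-difference z≤n       z≤n       = refl
square-of-difference z≤n       (s≤s z≤n) = refl
square-of-difference (s≤s z≤n) z≤n       = refl
square-of-difference (s≤s z≤n) (s≤s z≤n) = refl

-- In dimension 1 only the 1-deck is available, so F̂f² = F̂g² cannot be taken from the 2-deck;
-- instead the multiplicities are 0 or 1 and F̂f(1)² is the parity of f(0) + f(1).
products-agree-dim-1 : (f g : Multiset 1) → (∀ x → f x ≤ 1) → (∀ x → g x ≤ 1) →
  ZeroSumProductsAgree 1 f g → ZeroSumProductsAgree 2 f g
products-agree-dim-1 f g f≤1 g≤1 agree₁ ((false ∷ []) ∷ (false ∷ []) ∷ []) _ =
  cong (λ z → z * (z * 1ℤ)) (ℤ.*-cancelʳ-≡ (F̂ f 0ⁿ) (F̂ g 0ⁿ) 1ℤ (agree₁ (0ⁿ ∷ []) refl))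
products-agree-dim-1 f g f≤1 g≤1 agree₁ ((true ∷ []) ∷ (true ∷ []) ∷ []) _ = begin
  F̂ f 1ⁿ * (F̂ f 1ⁿ * 1ℤ)     ≡⟨ cong (F̂ f 1ⁿ *_) (ℤ.*-identityʳ (F̂ f 1ⁿ)) ⟩
  F̂ f 1ⁿ * F̂ f 1ⁿ            ≡⟨ square-of-difference (f≤1 0ⁿ) (f≤1 1ⁿ) ⟩
  + ((f 0ⁿ ℕ.+ f 1ⁿ) ℕ.% 2)  ≡⟨ cong (λ s → + (s ℕ.% 2)) total≡ ⟩
  + ((g 0ⁿ ℕ.+ g 1ⁿ) ℕ.% 2)  ≡⟨ square-of-difference (g≤1 0ⁿ) (g≤1 1ⁿ) ⟨
  F̂ g 1ⁿ * F̂ g 1ⁿ            ≡⟨ cong (F̂ g 1ⁿ *_) (ℤ.*-identityʳ (F̂ g 1ⁿ)) ⟨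
  F̂ g 1ⁿ * (F̂ g 1ⁿ * 1ℤ)     ∎
  where
  open ≡-Reasoning
  F̂-at-0ⁿ : (h : Multiset 1) → F̂ h 0ⁿ ≡ + (h 0ⁿ ℕ.+ h 1ⁿ)
  F̂-at-0ⁿ h = trans (cong₂ _+_ (ℤ.*-identityʳ (+ h 0ⁿ)) (ℤ.*-identityʳ (+ h 1ⁿ))) (sym (ℤ.pos-+ (h 0ⁿ) (h 1ⁿ)))
  total≡ : f 0ⁿ ℕ.+ f 1ⁿ ≡ g 0ⁿ ℕ.+ g 1ⁿ
  total≡ = ℤ.+-injective (trans (sym (F̂-at-0ⁿ f))
             (trans (ℤ.*-cancelʳ-≡ (F̂ f 0ⁿ) (F̂ g 0ⁿ) 1ℤ (agree₁ (0ⁿ ∷ []) refl)) (F̂-at-0ⁿ g)))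

products-agree-top : ∀ m (f g : Multiset (suc m)) → (∀ x → f x ≤ suc m) → (∀ x → g x ≤ suc m) →
  (∀ i → i ≤ suc m → ZeroSumProductsAgree i f g) → ZeroSumProductsAgree (suc (suc m)) f g
products-agree-top zero    f g f≤ g≤ agree = products-agree-dim-1 f g f≤ g≤ (agree 1 ℕ.≤-refl)
products-agree-top (suc m) f g f≤ g≤ agree = products-agree-from-dim-2 f g f≤ g≤ agree

indist-suc : ∀ m (f g : Multiset (suc m)) → (∀ x → f x ≤ suc m) → (∀ x → g x ≤ suc m) →
  Indist (suc m) f g → Indist (suc (suc m)) f g
indist-suc m f g f≤ g≤ indist i i≤ ss with i ℕ.≤? suc m
... | yes i≤m = indist i i≤m ss
... | no  i≰m with ℕ.≤-antisym i≤ (ℕ.≰⇒> i≰m)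
...   | refl = products-agree⇒decks-agree (suc (suc m)) f g
                 (products-agree-top m f g f≤ g≤
                   (λ j j≤m → decks-agree⇒products-agree j f g (indist j j≤m))) ss

some-≥-or-all-< : (h : Multiset n) (k : ℕ) → Σ (Z2^ n) (λ x → k ≤ h x) ⊎ (∀ x → h x ℕ.< k)
some-≥-or-all-< {zero} h k with k ℕ.≤? h []
... | yes k≤h = inj₁ ([] , k≤h)
... | no  k≰h = inj₂ (λ { [] → ℕ.≰⇒> k≰h })
some-≥-or-all-< {suc n} h k with some-≥-or-all-< (λ x → h (false ∷ x)) k
                               | some-≥-or-all-< (λ x → h (true ∷ x)) k
... | inj₁ (x , k≤h) | _              = inj₁ (false ∷ x , k≤h)
... | inj₂ _         | inj₁ (x , k≤h) = inj₁ (true ∷ x , k≤h)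
... | inj₂ h₀<k      | inj₂ h₁<k      = inj₂ (λ { (false ∷ x) → h₀<k x ; (true ∷ x) → h₁<k x })

theorem4p5 : (k : ℕ) → 2 ≤ k → (m : ℕ) → suc m ≡ k → (f g : Multiset m) →
    DistNum f g k → Σ (Z2^ m) (λ x → (k ≤ f x) ⊎ (k ≤ g x))
theorem4p5 .1 (s≤s ()) zero refl f g _
theorem4p5 .(suc (suc m)) _ (suc m) refl f g (dist , not-dist-below)
  with some-≥-or-all-< f (suc (suc m)) | some-≥-or-all-< g (suc (suc m))
... | inj₁ (x , k≤fx) | _               = x , inj₁ k≤fx
... | inj₂ _          | inj₁ (x , k≤gx) = x , inj₂ k≤gx
... | inj₂ f<k        | inj₂ g<k        =
  ⊥-elim (not-dist-below (suc m) ℕ.≤-refl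
    (λ indist → dist (indist-suc m f g (ℕ.≤-pred ∘ f<k) (ℕ.≤-pred ∘ g<k) indist)))
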